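{- The sequences $(S_n(q))_{n\ge1}$ and $(G_n(q))_{n\ge1}$ are $q$-Euler–Gauss sequences, and for every composite square-free integer $n$, neither satisfies $\sum_{d\mid n}\mu(d)\,a_{n/d}(q^d)\equiv0\pmod{[n]_q}$ (with $a=S$, resp. $a=G$).
   Context: For $n>1$, $s_n$ (resp. $g_n$) is the smallest (resp. greatest) prime factor of $n$. $\Phi_k(q)$ is the $k$-th cyclotomic polynomial. $S_1(q)=G_1(q)=\Phi_1(q)=q-1$, and for $n>1$, $S_n(q)=\Phi_{s_n}(q^{n/s_n})$, $G_n(q)=\Phi_{g_n}(q^{n/g_n})$. $[n]_q=1+q+\cdots+q^{n-1}$; $\mu$ is the Möbius function; congruences are in $\mathbb{Z}[q]$. A sequence $(a_n(q))$ in $\mathbb{Z}[q]$ is $q$-Euler–Gauss if for all $n\ge1$, $\prod_{d\mid n,\ \mu(d)=1} a_{n/d}(q^d)\equiv \prod_{d\mid n,\ \mu(d)=-1} a_{n/d}(q^d)\pmod{[n]_q}$ (empty products equal $1$). -}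

module Defs where

open import Data.Nat as ℕ using (ℕ; zero; suc; _∸_; _<_)
open import Data.Nat.Divisibility using (_∣_; _∣?_)
open import Data.Nat.Primality using (Prime; prime?)
open import Data.Integer as ℤ using (ℤ; +_; -[1+_])
open import Data.List using (List; []; _∷_; _++_; map; foldr; filter; reverse; drop; take; zipWith; length; replicate; applyUpTo; dropWhile; head; last)
open import Data.Maybe using (Maybe; just; nothing)
open import Data.Product using (_×_; _,_; proj₁; proj₂; ∃)
open import Relation.Binary.PropositionalEquality using (_≡_)
open import Relation.Nullary using (¬_; yes; no)
open import Relation.Nullary.Decidable using (_×-dec_; ⌊_⌋)
import Data.Bool
open Data.Bool using (if_then_else_; not)

-- Polynomials in ℤ[q], as coefficient lists, lowest degree first.
-- Trailing zeros are allowed; equality of polynomials is coefficientwise.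

Poly : Set
Poly = List ℤ

coeff : Poly → ℕ → ℤ
coeff []       _       = + 0
coeff (c ∷ _)  zero    = c
coeff (_ ∷ cs) (suc i) = coeff cs i

_≈P_ : Poly → Poly → Set
a ≈P b = ∀ i → coeff a i ≡ coeff b i

infix 4 _≈P_

_+P_ : Poly → Poly → Poly
[]       +P b        = b
(x ∷ a)  +P []       = x ∷ a
(x ∷ a)  +P (y ∷ b)  = (x ℤ.+ y) ∷ (a +P b)

-P_ : Poly → Poly
-P a = map ℤ.-_ a

_-P_ : Poly → Poly → Poly
a -P b = a +P (-P b)

scaleP : ℤ → Poly → Poly
scaleP c a = map (c ℤ.*_) a

_*P_ : Poly → Poly → Poly
[]      *P b = []
(c ∷ a) *P b = scaleP c b +P (+ 0 ∷ (a *P b))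

infixl 6 _+P_ _-P_
infixl 7 _*P_

oneP : Poly
oneP = + 1 ∷ []

zeroP : Poly
zeroP = []

productP : List Poly → Poly
productP = foldr _*P_ oneP

sumP : List Poly → Poly
sumP = foldr _+P_ zeroP

qMinus1 : Poly
qMinus1 = -[1+ 0 ] ∷ + 1 ∷ []

qPowMinus1 : ℕ → Poly
qPowMinus1 zero    = []
qPowMinus1 (suc k) = -[1+ 0 ] ∷ (replicate k (+ 0) ++ (+ 1 ∷ []))

qInt : ℕ → Poly
qInt n = replicate n (+ 1)

-- substitution q ↦ q^d : (p)(q^d), for d ≥ 1
substPow : ℕ → Poly → Poly
substPow d []       = []
substPow d (c ∷ [])     = c ∷ []
substPow d (c ∷ c' ∷ cs) = c ∷ (replicate (d ∸ 1) (+ 0) ++ substPow d (c' ∷ cs))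

_≡P_[mod_] : Poly → Poly → Poly → Set
a ≡P b [mod m ] = ∃ λ h → a -P b ≈P h *P m

-- Exact division by a monic polynomial (long division), used to define
-- the cyclotomic polynomials via  q^k - 1 = ∏_{d ∣ k} Φ_d(q).

private
  strip : Poly → Poly
  strip a = reverse (dropWhile (λ x → x ℤ.≟ + 0) (reverse a))

  -- high-degree-first long division; returns quotient (high-first)
  divH : ℕ → List ℤ → List ℤ → List ℤ
  divH zero    a b = []
  divH (suc f) a b with length b ℕ.≤? length a
  divH (suc f) []      b | yes _ = []
  divH (suc f) (c ∷ a) b | yes _ =
    c ∷ divH f (drop 1 (zipWith (λ x y → x ℤ.- c ℤ.* y) (take (length b) (c ∷ a)) b
                        ++ drop (length b) (c ∷ a))) b
  divH (suc f) a b | no _ = []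

divMonic : Poly → Poly → Poly
divMonic a b = reverse (divH (length a) (reverse (strip a)) (reverse (strip b)))

cycloTable : ℕ → List (ℕ × Poly)
cycloTable zero    = []
cycloTable (suc k) =
  cycloTable k ++
  ((suc k , divMonic (qPowMinus1 (suc k))
                     (productP (map proj₂ (filter (λ dp → proj₁ dp ∣? suc k) (cycloTable k)))))
   ∷ [])

private
  lookupΦ : ℕ → List (ℕ × Poly) → Poly
  lookupΦ k []             = []
  lookupΦ k ((d , p) ∷ ps) with d ℕ.≟ k
  ... | yes _ = p
  ... | no  _ = lookupΦ k ps

Φ : ℕ → Poly
Φ k = lookupΦ k (cycloTable k)

_÷_ : ℕ → ℕ → ℕ
n ÷ zero  = 0
n ÷ suc d = n ℕ./ suc d

primeDivisors : ℕ → List ℕ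
primeDivisors n = filter (λ p → prime? p ×-dec p ∣? n) (applyUpTo suc n)

divisors : ℕ → List ℕ
divisors n = filter (λ d → d ∣? n) (applyUpTo suc n)

private
  fromMaybe0 : Maybe ℕ → ℕ
  fromMaybe0 (just x) = x
  fromMaybe0 nothing  = 0

-- smallest / greatest prime factor s_n, g_n (meaningful for n > 1)
spf : ℕ → ℕ
spf n = fromMaybe0 (head (primeDivisors n))

gpf : ℕ → ℕ
gpf n = fromMaybe0 (last (primeDivisors n))

SquareFree : ℕ → Set
SquareFree n = ∀ p → Prime p → ¬ (p ℕ.* p ∣ n)

μ : ℕ → ℤ
μ n = if allB (λ p → not ⌊ p ℕ.* p ∣? n ⌋) (primeDivisors n)
      then signPow (length (primeDivisors n))
      else + 0
  where
  allB : (ℕ → Data.Bool.Bool) → List ℕ → Data.Bool.Bool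
  allB f []       = Data.Bool.true
  allB f (x ∷ xs) = f x Data.Bool.∧ allB f xs

  signPow : ℕ → ℤ
  signPow zero    = + 1
  signPow (suc k) = ℤ.- signPow k

-- The sequences S_n and G_n (indexed by n ≥ 1; the value at 0 is unused)

private
  fromPrime : ℕ → ℕ → Poly
  fromPrime n zero    = qMinus1
  fromPrime n (suc k) = substPow (n ÷ suc k) (Φ (suc k))

S : ℕ → Poly
S zero          = qMinus1
S (suc zero)    = qMinus1
S n@(suc (suc _)) = fromPrime n (spf n)

G : ℕ → Poly
G zero          = qMinus1
G (suc zero)    = qMinus1
G n@(suc (suc _)) = fromPrime n (gpf n)

divProd : (ℕ → Poly) → ℤ → ℕ → Poly
divProd a ε n =
  productP (map (λ d → substPow d (a (n ÷ d)))
                (filter (λ d → μ d ℤ.≟ ε) (divisors n)))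

IsQEulerGauss : (ℕ → Poly) → Set
IsQEulerGauss a =
  ∀ n → 1 ℕ.≤ n → divProd a (+ 1) n ≡P divProd a -[1+ 0 ] n [mod qInt n ]

mobiusSum : (ℕ → Poly) → ℕ → Poly
mobiusSum a n = sumP (map (λ d → scaleP (μ d) (substPow d (a (n ÷ d)))) (divisors n))

{-# OPTIONS --safe #-}
module Submission where

-- Write a_m = [p]_{q^{m/p}} with p = E m the least (for S) or greatest (for G) prime factor of m,
-- so that a_{n/d}(q^d) = [p]_{q^{n/p}} with p = E (n/d) for every proper divisor d of n. Let r be
-- the prime factor of n at the other extreme. Toggling r (d ↦ d/r or d r) is an involution on the
-- squarefree divisors of n that flips μ and, away from n itself, preserves E (n/d). For n not
-- squarefree it therefore matches the two products of the Euler–Gauss congruence factor by factor.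
-- For squarefree n both products are multiples of [n]_q: one contains a_1(q^n) = q^n - 1, the
-- other contains ∏_{p ∣ n} [p]_{q^{n/p}}, a multiple of [n]_q because [p m] = [p] [m]_{q^p} and
-- [p] divides [p]_{q^m} when p ∤ m. In the Möbius sum the toggle cancels every divisor except n and
-- n/r, so at q = 1 the sum is ±r, which a composite n does not divide.

open import Defs
open import Algebra.Bundles using (CommutativeRing; CommutativeMonoid)
open import Data.Bool using (Bool; true; not; _∧_; if_then_else_)
open import Data.Bool.ListAction using (all)
open import Data.Bool.Properties using (T-≡; ¬-not)
open import Data.Empty using (⊥; ⊥-elim)
open import Data.Integer as ℤ using (ℤ; +_; -[1+_])
import Data.Integer.Properties as ℤ
import Data.Integer.Tactic.RingSolver as ℤ-Solver
open import Data.List using (List; []; _∷_; _++_; _∷ʳ_; [_]; map; filter; foldr; foldl; reverse; replicate; applyUpTo; head; last; length)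
open import Data.List.Properties using (map-∘; unfold-reverse; reverse-++; reverse-involutive; filter-accept; filter-none)
open import Data.List.Membership.Propositional using (_∈_)
open import Data.List.Membership.Propositional.Properties using (∈-applyUpTo⁺; ∈-applyUpTo⁻; ∈-filter⁺; ∈-filter⁻; ∈-map⁺; ∈-map⁻)
open import Data.List.Membership.Propositional.Properties.WithK using (unique∧set⇒bag)
open import Data.List.Relation.Binary.BagAndSetEquality using (∼bag⇒↭)
open import Data.List.Relation.Binary.Permutation.Propositional as ↭ using (_↭_)
open import Data.List.Relation.Binary.Permutation.Propositional.Properties using (↭-length)
open import Data.List.Relation.Unary.All as All using (All; []; _∷_)
import Data.List.Relation.Unary.All.Properties as All
open import Data.List.Relation.Unary.AllPairs as AllPairs using (AllPairs; []; _∷_)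
import Data.List.Relation.Unary.AllPairs.Properties as AllPairs
open import Data.List.Relation.Unary.Any using (here; there)
open import Data.List.Relation.Unary.Unique.Propositional using (Unique)
import Data.List.Relation.Unary.Unique.Propositional.Properties as Unique
open import Data.Maybe using (just; nothing)
open import Data.Nat as ℕ using (ℕ; zero; suc; _∸_; _*_; _≤_; _<_; _≥_; s≤s; z≤n; NonZero; nonTrivial⇒n>1; nonTrivial⇒nonZero)
import Data.Nat.Properties as ℕ
open import Data.List.Membership.DecPropositional ℕ._≟_ using (_∈?_)
import Data.Nat.Tactic.RingSolver as ℕ-Solver
open import Data.Nat.Coprimality as Coprime using (Coprime; coprime-divisor; coprime-Bézout)
open import Data.Nat.Divisibility as ℕ∣ using (_∣_; _∣?_; divides; ∣⇒≤; ∣-trans; 1∣_; 0∣⇒≡0; m/n∣m; *-cancelʳ-∣)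
open import Data.Nat.DivMod using (_/_; m*[n/m]≡n; *-/-assoc; n/n≡1; m*n/n≡m)
open import Data.Nat.GCD using (module Bézout)
open import Data.Nat.Primality using (Prime; Composite; prime?; prime[2]; ¬prime[0]; ¬prime[1]; euclidsLemma; prime⇒irreducible; prime⇒nonZero; composite⇒nonTrivial; composite⇒¬prime)
open import Data.Nat.Primality.Factorisation using (factorise)
open import Data.Product using (_×_; _,_; ∃; proj₁; proj₂)
open import Data.Sum using (_⊎_; inj₁; inj₂; reduce; swap)
open import Function using (_∘_; flip; case_of_)
open import Function.Bundles using (_⇔_; mk⇔; Equivalence)
open import Level using (0ℓ)
open import Relation.Binary.Bundles using (Setoid)
open import Relation.Binary.PropositionalEquality using (_≡_; _≢_; refl; sym; trans; cong; cong₂; subst; module ≡-Reasoning)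
open import Relation.Binary.Structures using (IsEquivalence)
import Relation.Binary.Reasoning.Setoid as SetoidReasoning
open import Relation.Nullary using (¬_; ¬?; Dec; yes; no; contradiction)
open import Relation.Nullary.Decidable using (_×-dec_; ⌊_⌋; fromWitnessFalse; toWitnessFalse)
open import Relation.Unary using (Pred; Decidable)

∈-head : ∀ {xs : List ℕ} {x} → head xs ≡ just x → x ∈ xs
∈-head {_ ∷ _} refl = here refl

∈-last : ∀ {xs : List ℕ} {x} → last xs ≡ just x → x ∈ xs
∈-last {_ ∷ []}     refl = here refl
∈-last {_ ∷ _ ∷ _}  eq   = there (∈-last eq)

head≡nothing⇒∉ : ∀ {xs : List ℕ} {x} → head xs ≡ nothing → x ∈ xs → ⊥
head≡nothing⇒∉ {_ ∷ _} () _

last≡nothing⇒∉ : ∀ {xs : List ℕ} {x} → last xs ≡ nothing → x ∈ xs → ⊥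
last≡nothing⇒∉ {_ ∷ []}    ()
last≡nothing⇒∉ {_ ∷ y ∷ ys} eq _ = last≡nothing⇒∉ {y ∷ ys} eq (here refl)

head-minimal : ∀ {xs x} → AllPairs _<_ xs → head xs ≡ just x → All (x ≤_) xs
head-minimal (x<xs ∷ _) refl = ℕ.≤-refl ∷ All.map ℕ.<⇒≤ x<xs

last-maximal : ∀ {xs x} → AllPairs _<_ xs → last xs ≡ just x → All (_≤ x) xs
last-maximal {_ ∷ []}    _              refl = ℕ.≤-refl ∷ []
last-maximal {_ ∷ y ∷ ys} (x<ys ∷ sorted) eq = ℕ.<⇒≤ (All.lookup x<ys (∈-last {y ∷ ys} eq)) ∷ last-maximal sorted eq

↭-fromMembership : ∀ {xs ys : List ℕ} → Unique xs → Unique ys → (∀ {x} → x ∈ xs ⇔ x ∈ ys) → xs ↭ ys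
↭-fromMembership xs! ys! same = ∼bag⇒↭ (unique∧set⇒bag xs! ys! same)

module _ {P : Pred ℕ 0ℓ} (P? : Decidable P) where

  filterUpTo-sorted : ∀ n → AllPairs _<_ (filter P? (applyUpTo suc n))
  filterUpTo-sorted n = AllPairs.filter⁺ P? (AllPairs.applyUpTo⁺₁ suc n (λ i<j _ → s≤s i<j))

  ∈-filterUpTo⁺ : ∀ {n x} .{{_ : NonZero x}} → x ≤ n → P x → x ∈ filter P? (applyUpTo suc n)
  ∈-filterUpTo⁺ {x = suc i} i<n Px = ∈-filter⁺ P? (∈-applyUpTo⁺ suc i<n) Px

  ∈-filterUpTo⁻ : ∀ n {x} → x ∈ filter P? (applyUpTo suc n) → NonZero x × P x
  ∈-filterUpTo⁻ n x∈ with ∈-filter⁻ P? {xs = applyUpTo suc n} x∈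
  ... | x∈upTo , Px with ∈-applyUpTo⁻ suc x∈upTo
  ... | _ , _ , refl = _ , Px

prime⇒1< : ∀ {p} → Prime p → 1 < p
prime⇒1< {suc (suc _)} _ = s≤s (s≤s z≤n)

prime≡ : ∀ {p q} → Prime p → Prime q → p ∣ q → p ≡ q
prime≡ p-prime q-prime p∣q with prime⇒irreducible q-prime p∣q
... | inj₁ refl = contradiction p-prime ¬prime[1]
... | inj₂ p≡q  = p≡q

prime∤⇒coprime : ∀ {r m} → Prime r → ¬ r ∣ m → Coprime r m
prime∤⇒coprime r-prime r∤m (d∣r , d∣m) with prime⇒irreducible r-prime d∣r
... | inj₁ d≡1 = d≡1
... | inj₂ refl = contradiction d∣m r∤m

∃prime∣ : ∀ m → 1 < m → ∃ λ p → Prime p × p ∣ m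
∃prime∣ (suc zero) (s≤s ())
∃prime∣ m@(suc (suc _)) _ with factorise m
... | record { factors = p ∷ ps ; isFactorisation = m≡p*ps ; factorsPrime = p-prime ∷ _ } =
  p , p-prime , subst (p ∣_) (sym m≡p*ps) (ℕ∣.m∣m*n _)

∣∧prime∣⇒*∣ : ∀ {e r n} → e ∣ n → Prime r → r ∣ n → ¬ r ∣ e → e * r ∣ n
∣∧prime∣⇒*∣ {e} {r} (divides k refl) r-prime r∣ke r∤e with euclidsLemma k e r-prime r∣ke
... | inj₂ r∣e = contradiction r∣e r∤e
... | inj₁ (divides j refl) = divides j (regroup j r e)
  where
  regroup : ∀ j r e → j * r * e ≡ j * (e * r)
  regroup = ℕ-Solver.solve-∀

prime∣composite⇒< : ∀ {n r} → Composite n → Prime r → r ∣ n → r < n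
prime∣composite⇒< {n} composite r-prime r∣n =
  ℕ.≤∧≢⇒< (∣⇒≤ {{nonTrivial⇒nonZero n {{composite⇒nonTrivial composite}}}} r∣n)
          (λ r≡n → composite⇒¬prime composite (subst Prime r≡n r-prime))

≢-multiple : ∀ {m n} .{{_ : NonZero m}} → m < n → ∀ k → m ≢ k * n
≢-multiple {m}     m<n zero    m≡0     = ℕ.≢-nonZero⁻¹ m m≡0
≢-multiple {m} {n} m<n (suc k) m≡[k+1]n = ℕ.<⇒≱ m<n (subst (n ≤_) (sym m≡[k+1]n) (ℕ.m≤m+n n (k * n)))

∣⇒nonZero : ∀ {d n} .{{_ : NonZero n}} → d ∣ n → NonZero d
∣⇒nonZero {zero} {n} 0∣n = contradiction (0∣⇒≡0 0∣n) (ℕ.≢-nonZero⁻¹ n)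
∣⇒nonZero {suc d}    _   = _

÷≡/ : ∀ n d .{{_ : NonZero d}} → n ÷ d ≡ n / d
÷≡/ n (suc d) = refl

*-÷-cancel : ∀ {n d} .{{_ : NonZero d}} → d ∣ n → d * (n ÷ d) ≡ n
*-÷-cancel {n} {d} d∣n = trans (cong (d *_) (÷≡/ n d)) (m*[n/m]≡n d∣n)

*-÷-cancelˡ : ∀ m d .{{_ : NonZero d}} → (d * m) ÷ d ≡ m
*-÷-cancelˡ m d = trans (÷≡/ (d * m) d) (trans (cong (_/ d) (ℕ.*-comm d m)) (m*n/n≡m m d))

*-÷-assoc : ∀ m {n d} .{{_ : NonZero d}} → d ∣ n → (m * n) ÷ d ≡ m * (n ÷ d)
*-÷-assoc m {n} {d} d∣n = trans (÷≡/ (m * n) d) (trans (*-/-assoc m d∣n) (cong (m *_) (sym (÷≡/ n d))))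

÷-∣ : ∀ {n d} .{{_ : NonZero d}} → d ∣ n → n ÷ d ∣ n
÷-∣ {n} {d} d∣n = subst (_∣ n) (sym (÷≡/ n d)) (m/n∣m d∣n)

÷-nonZero : ∀ {n d} .{{_ : NonZero n}} .{{_ : NonZero d}} → d ∣ n → NonZero (n ÷ d)
÷-nonZero d∣n = ∣⇒nonZero (÷-∣ d∣n)

÷-÷ : ∀ {n d} .{{_ : NonZero n}} .{{_ : NonZero d}} → d ∣ n → n ÷ (n ÷ d) ≡ d
÷-÷ {n} {d} d∣n = begin
  n ÷ (n ÷ d)              ≡⟨ cong (_÷ (n ÷ d)) (*-÷-cancel d∣n) ⟨
  (d * (n ÷ d)) ÷ (n ÷ d)  ≡⟨ cong (_÷ (n ÷ d)) (ℕ.*-comm d _) ⟩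
  ((n ÷ d) * d) ÷ (n ÷ d)  ≡⟨ *-÷-cancelˡ d (n ÷ d) {{÷-nonZero d∣n}} ⟩
  d                        ∎
  where open ≡-Reasoning

n÷n≡1 : ∀ n .{{_ : NonZero n}} → n ÷ n ≡ 1
n÷n≡1 n = trans (÷≡/ n n) (n/n≡1 n)

1<÷ : ∀ {n d} .{{_ : NonZero n}} .{{_ : NonZero d}} → d ∣ n → d ≢ n → 1 < n ÷ d
1<÷ {n} {d} d∣n d≢n with n ÷ d in eq | ÷-nonZero {n} {d} d∣n
... | suc zero    | _ = contradiction (trans (sym (ℕ.*-identityʳ d)) (trans (cong (d *_) (sym eq)) (*-÷-cancel d∣n))) d≢n
... | suc (suc _) | _ = s≤s (s≤s z≤n)

÷-≢ : ∀ {n p} .{{_ : NonZero n}} .{{_ : NonZero p}} → 1 < p → p ∣ n → n ÷ p ≢ n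
÷-≢ {n} {p} 1<p p∣n n÷p≡n = ℕ.<-irrefl (trans (sym (n÷n≡1 n)) (trans (cong (n ÷_) (sym n÷p≡n)) (÷-÷ p∣n))) 1<p

primeDivisor? : ∀ n → Decidable (λ p → Prime p × p ∣ n)
primeDivisor? n p = prime? p ×-dec p ∣? n

∈-primeDivisors⁺ : ∀ {n p} .{{_ : NonZero n}} → Prime p → p ∣ n → p ∈ primeDivisors n
∈-primeDivisors⁺ {n} p-prime p∣n = ∈-filterUpTo⁺ (primeDivisor? n) {{prime⇒nonZero p-prime}} (∣⇒≤ p∣n) (p-prime , p∣n)

∈-primeDivisors⁻ : ∀ n {p} → p ∈ primeDivisors n → Prime p × p ∣ n
∈-primeDivisors⁻ n p∈ = proj₂ (∈-filterUpTo⁻ (primeDivisor? n) n p∈)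

∈-primeDivisors⇔ : ∀ {n p} .{{_ : NonZero n}} → p ∈ primeDivisors n ⇔ (Prime p × p ∣ n)
∈-primeDivisors⇔ {n} = mk⇔ (∈-primeDivisors⁻ n) (λ (p-prime , p∣n) → ∈-primeDivisors⁺ p-prime p∣n)

primeDivisors-unique : ∀ n → Unique (primeDivisors n)
primeDivisors-unique n = AllPairs.map ℕ.<⇒≢ (filterUpTo-sorted (primeDivisor? n) n)

∃primeDivisor : ∀ m → 1 < m → ∃ λ p → p ∈ primeDivisors m
∃primeDivisor m 1<m with ∃prime∣ m 1<m
... | p , p-prime , p∣m = p , ∈-primeDivisors⁺ {{ℕ.>-nonZero (ℕ.<-trans ℕ.z<s 1<m)}} p-prime p∣m

record Extremal (_≼_ : ℕ → ℕ → Set) (m e : ℕ) : Set where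
  field
    isPrime  : Prime e
    ∣m       : e ∣ m
    extremal : ∀ {p} → Prime p → p ∣ m → e ≼ p

-- spf and gpf read 0 off an empty list; for m ≥ 2 it is not empty.
spf-extremal : ∀ m → 1 < m → Extremal _≤_ m (spf m)
spf-extremal m 1<m with head (primeDivisors m) in eq | ∃primeDivisor m 1<m
... | nothing | _ , p∈ = ⊥-elim (head≡nothing⇒∉ eq p∈)
... | just x  | _ = record
  { isPrime  = proj₁ (∈-primeDivisors⁻ m (∈-head eq))
  ; ∣m       = proj₂ (∈-primeDivisors⁻ m (∈-head eq))
  ; extremal = λ p-prime p∣m → All.lookup (head-minimal (filterUpTo-sorted (primeDivisor? m) m) eq)
                                          (∈-primeDivisors⁺ {{ℕ.>-nonZero (ℕ.<-trans ℕ.z<s 1<m)}} p-prime p∣m) }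

gpf-extremal : ∀ m → 1 < m → Extremal _≥_ m (gpf m)
gpf-extremal m 1<m with last (primeDivisors m) in eq | ∃primeDivisor m 1<m
... | nothing | _ , p∈ = ⊥-elim (last≡nothing⇒∉ eq p∈)
... | just x  | _ = record
  { isPrime  = proj₁ (∈-primeDivisors⁻ m (∈-last eq))
  ; ∣m       = proj₂ (∈-primeDivisors⁻ m (∈-last eq))
  ; extremal = λ p-prime p∣m → All.lookup (last-maximal (filterUpTo-sorted (primeDivisor? m) m) eq)
                                          (∈-primeDivisors⁺ {{ℕ.>-nonZero (ℕ.<-trans ℕ.z<s 1<m)}} p-prime p∣m) }

∈-divisors⁺ : ∀ {n d} .{{_ : NonZero n}} → d ∣ n → d ∈ divisors n
∈-divisors⁺ {n} d∣n = ∈-filterUpTo⁺ (_∣? n) {{∣⇒nonZero d∣n}} (∣⇒≤ d∣n) d∣n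

∈-divisors⁻ : ∀ n {d} → d ∈ divisors n → d ∣ n
∈-divisors⁻ n d∈ = proj₂ (∈-filterUpTo⁻ (_∣? n) n d∈)

divisors-unique : ∀ n → Unique (divisors n)
divisors-unique n = AllPairs.map ℕ.<⇒≢ (filterUpTo-sorted (_∣? n) n)

-- Squarefree numbers and the Möbius function

squareFree[1] : SquareFree 1
squareFree[1] p p-prime p²∣1 = ¬prime[1] (subst Prime (ℕ.m*n≡1⇒n≡1 p p (ℕ∣.∣1⇒≡1 p²∣1)) p-prime)

squareFree⇒nonZero : ∀ {n} → SquareFree n → NonZero n
squareFree⇒nonZero {zero}  sf = contradiction (ℕ∣._∣0 4) (sf 2 prime[2])
squareFree⇒nonZero {suc n} _  = _

squareFree-∣ : ∀ {n d} → SquareFree n → d ∣ n → SquareFree d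
squareFree-∣ sf d∣n p p-prime p²∣d = sf p p-prime (∣-trans p²∣d d∣n)

squareFree-* : ∀ {d r} → SquareFree d → Prime r → ¬ r ∣ d → SquareFree (d * r)
squareFree-* {d} {r} sf r-prime r∤d p p-prime p²∣dr with p ℕ.≟ r
... | yes refl = r∤d (*-cancelʳ-∣ p {{prime⇒nonZero p-prime}} p²∣dr)
... | no p≢r   = sf p p-prime (coprime-divisor (Coprime.sym (prime∤⇒coprime r-prime r∤p²)) (subst (p * p ∣_) (ℕ.*-comm d r) p²∣dr))
  where
  r∤p² : ¬ r ∣ p * p
  r∤p² r∣p² = p≢r (sym (prime≡ r-prime p-prime (reduce (euclidsLemma p p r-prime r∣p²))))

squareFree⇒∤÷ : ∀ {n p} → SquareFree n → Prime p → p ∣ n → ¬ p ∣ n ÷ p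
squareFree⇒∤÷ {n} {p} sf p-prime p∣n p∣n÷p =
  sf p p-prime (subst (p * p ∣_) (*-÷-cancel {{prime⇒nonZero p-prime}} p∣n) (ℕ∣.*-monoʳ-∣ p p∣n÷p))

primeDivisors-* : ∀ {d r} .{{_ : NonZero d}} → Prime r → ¬ r ∣ d → primeDivisors (d * r) ↭ r ∷ primeDivisors d
primeDivisors-* {d} {r} r-prime r∤d =
  ↭-fromMembership (primeDivisors-unique (d * r)) (r∉ ∷ primeDivisors-unique d) (mk⇔ to from)
  where
  instance
    r≢0 : NonZero r
    r≢0 = prime⇒nonZero r-prime
    dr≢0 : NonZero (d * r)
    dr≢0 = ℕ.m*n≢0 d r
  r∉ : All (r ≢_) (primeDivisors d)
  r∉ = All.tabulate λ p∈ r≡p → r∤d (subst (_∣ d) (sym r≡p) (proj₂ (∈-primeDivisors⁻ d p∈)))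
  to : ∀ {p} → p ∈ primeDivisors (d * r) → p ∈ r ∷ primeDivisors d
  to p∈ with ∈-primeDivisors⁻ (d * r) p∈
  ... | p-prime , p∣dr with euclidsLemma d r p-prime p∣dr
  ...   | inj₁ p∣d = there (∈-primeDivisors⁺ p-prime p∣d)
  ...   | inj₂ p∣r = here (prime≡ p-prime r-prime p∣r)
  from : ∀ {p} → p ∈ r ∷ primeDivisors d → p ∈ primeDivisors (d * r)
  from (here refl) = ∈-primeDivisors⁺ r-prime (ℕ∣.n∣m*n d)
  from (there p∈) with ∈-primeDivisors⁻ d p∈
  ... | p-prime , p∣d = ∈-primeDivisors⁺ p-prime (∣-trans p∣d (ℕ∣.m∣m*n r))

negOnePow : ℕ → ℤ
negOnePow zero    = + 1
negOnePow (suc k) = ℤ.- negOnePow k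

noSquareOf : ℕ → ℕ → Bool
noSquareOf n p = not ⌊ p * p ∣? n ⌋

-- μ is defined through functions local to its where-block; they are identified with `all`
-- and negOnePow through their defining equations, which unification supplies once the list
-- of prime divisors is abstracted.
μ-unfold : ∀ n → μ n ≡ (if all (noSquareOf n) (primeDivisors n) then negOnePow (length (primeDivisors n)) else + 0)
μ-unfold n with primeDivisors n | all-by-equations (noSquareOf n) _ refl (λ _ _ → refl) | negOnePow-by-equations _ refl (λ _ → refl)
  where
  all-by-equations : ∀ (f : ℕ → Bool) (g : List ℕ → Bool) →
                     g [] ≡ true → (∀ x xs → g (x ∷ xs) ≡ (f x ∧ g xs)) → ∀ xs → g xs ≡ all f xs
  all-by-equations f g g[] g∷ []       = g[]
  all-by-equations f g g[] g∷ (x ∷ xs) = trans (g∷ x xs) (cong (f x ∧_) (all-by-equations f g g[] g∷ xs))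
  negOnePow-by-equations : ∀ (g : ℕ → ℤ) → g 0 ≡ + 1 → (∀ k → g (suc k) ≡ ℤ.- g k) → ∀ k → g k ≡ negOnePow k
  negOnePow-by-equations g g0 gsuc zero    = g0
  negOnePow-by-equations g g0 gsuc (suc k) = trans (gsuc k) (cong ℤ.-_ (negOnePow-by-equations g g0 gsuc k))
... | ps | allB≗all | signPow≗ with length ps | if_then_else_ {A = ℤ}
... | k | if′ = cong₂ (λ b s → if′ b s (+ 0)) (allB≗all ps) (signPow≗ k)

μ-squareFree : ∀ {n} → SquareFree n → μ n ≡ negOnePow (length (primeDivisors n))
μ-squareFree {n} sf = trans (μ-unfold n) (cong (λ b → if b then negOnePow (length (primeDivisors n)) else + 0)
  (Equivalence.to T-≡ (All.all⁻ (noSquareOf n) (All.tabulate λ p∈ → fromWitnessFalse (sf _ (proj₁ (∈-primeDivisors⁻ n p∈)))))))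

μ-nonSquareFree : ∀ {n p} .{{_ : NonZero n}} → Prime p → p * p ∣ n → μ n ≡ + 0
μ-nonSquareFree {n} {p} p-prime p²∣n = trans (μ-unfold n) (cong (λ b → if b then negOnePow (length (primeDivisors n)) else + 0)
  (¬-not λ all≡true → toWitnessFalse (All.lookup (All.all⁺ (noSquareOf n) _ (Equivalence.from T-≡ all≡true)) p∈) p²∣n))
  where
  p∈ : p ∈ primeDivisors n
  p∈ = ∈-primeDivisors⁺ p-prime (∣-trans (ℕ∣.m∣m*n p) p²∣n)

μ-* : ∀ {d r} → SquareFree d → Prime r → ¬ r ∣ d → μ (d * r) ≡ ℤ.- μ d
μ-* {d} {r} sf r-prime r∤d = begin
  μ (d * r)                                           ≡⟨ μ-squareFree (squareFree-* sf r-prime r∤d) ⟩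
  negOnePow (length (primeDivisors (d * r)))          ≡⟨ cong negOnePow (↭-length (primeDivisors-* {{squareFree⇒nonZero sf}} r-prime r∤d)) ⟩
  ℤ.- negOnePow (length (primeDivisors d))            ≡⟨ cong ℤ.-_ (μ-squareFree sf) ⟨
  ℤ.- μ d                                             ∎
  where open ≡-Reasoning

μ-÷ : ∀ {n p} → SquareFree n → Prime p → p ∣ n → μ (n ÷ p) ≡ ℤ.- μ n
μ-÷ {n} {p} sf p-prime p∣n = begin
  μ (n ÷ p)                      ≡⟨ ℤ.neg-involutive _ ⟨
  ℤ.- (ℤ.- μ (n ÷ p))            ≡⟨ cong ℤ.-_ (μ-* (squareFree-∣ sf (÷-∣ p∣n)) p-prime (squareFree⇒∤÷ sf p-prime p∣n)) ⟨
  ℤ.- μ ((n ÷ p) * p)            ≡⟨ cong (ℤ.-_ ∘ μ) n≡[n÷p]*p ⟨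
  ℤ.- μ n                        ∎
  where
  open ≡-Reasoning
  instance
    p≢0 : NonZero p
    p≢0 = prime⇒nonZero p-prime
  n≡[n÷p]*p : n ≡ (n ÷ p) * p
  n≡[n÷p]*p = trans (sym (*-÷-cancel p∣n)) (ℕ.*-comm p _)

negOnePow≡±1 : ∀ k → negOnePow k ≡ + 1 ⊎ negOnePow k ≡ -[1+ 0 ]
negOnePow≡±1 zero    = inj₁ refl
negOnePow≡±1 (suc k) with negOnePow≡±1 k
... | inj₁ ≡1  = inj₂ (cong ℤ.-_ ≡1)
... | inj₂ ≡-1 = inj₁ (cong ℤ.-_ ≡-1)

μ≡±1 : ∀ {n} → SquareFree n → μ n ≡ + 1 ⊎ μ n ≡ -[1+ 0 ]
μ≡±1 {n} sf with negOnePow≡±1 (length (primeDivisors n))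
... | inj₁ ≡1  = inj₁ (trans (μ-squareFree sf) ≡1)
... | inj₂ ≡-1 = inj₂ (trans (μ-squareFree sf) ≡-1)

∣μ∣≡1 : ∀ {n} → SquareFree n → ℤ.∣ μ n ∣ ≡ 1
∣μ∣≡1 sf with μ≡±1 sf
... | inj₁ μ≡1  = cong ℤ.∣_∣ μ≡1
... | inj₂ μ≡-1 = cong ℤ.∣_∣ μ≡-1

squareFree⇒μ≢0 : ∀ {n} → SquareFree n → μ n ≢ + 0
squareFree⇒μ≢0 sf μ≡0 with μ≡±1 sf
... | inj₁ μ≡1  = case trans (sym μ≡1) μ≡0 of λ ()
... | inj₂ μ≡-1 = case trans (sym μ≡-1) μ≡0 of λ ()

μ≢0⇒squareFree : ∀ {n} .{{_ : NonZero n}} → μ n ≢ + 0 → SquareFree n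
μ≢0⇒squareFree μ≢0 p p-prime p²∣n = μ≢0 (μ-nonSquareFree p-prime p²∣n)

squareFree? : ∀ n .{{_ : NonZero n}} → Dec (SquareFree n)
squareFree? n with μ n ℤ.≟ + 0
... | no  μ≢0 = yes (μ≢0⇒squareFree μ≢0)
... | yes μ≡0 = no λ sf → squareFree⇒μ≢0 sf μ≡0

divisorsWithμ : ℤ → ℕ → List ℕ
divisorsWithμ ε n = filter (λ d → μ d ℤ.≟ ε) (divisors n)

∈-divisorsWithμ⁺ : ∀ {ε n d} .{{_ : NonZero n}} → d ∣ n → μ d ≡ ε → d ∈ divisorsWithμ ε n
∈-divisorsWithμ⁺ {ε} d∣n μd≡ε = ∈-filter⁺ (λ d → μ d ℤ.≟ ε) (∈-divisors⁺ d∣n) μd≡ε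

∈-divisorsWithμ⁻ : ∀ {ε n d} → d ∈ divisorsWithμ ε n → d ∣ n × μ d ≡ ε
∈-divisorsWithμ⁻ {ε} {n} d∈ with ∈-filter⁻ (λ d → μ d ℤ.≟ ε) {xs = divisors n} d∈
... | d∈divisors , μd≡ε = ∈-divisors⁻ n d∈divisors , μd≡ε

divisorsWithμ-unique : ∀ ε n → Unique (divisorsWithμ ε n)
divisorsWithμ-unique ε n = Unique.filter⁺ (λ d → μ d ℤ.≟ ε) (divisors-unique n)

∈-divisorsWithμ⇒squareFree : ∀ {ε n d} → ε ≢ + 0 → d ∈ divisorsWithμ ε n → SquareFree d
∈-divisorsWithμ⇒squareFree {ε} {n} ε≢0 d∈ with ∈-filter⁻ (λ d → μ d ℤ.≟ ε) {xs = divisors n} d∈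
... | d∈divisors , μd≡ε with ∈-filterUpTo⁻ (_∣? n) n d∈divisors
...   | d≢0 , _ = μ≢0⇒squareFree {{d≢0}} λ μd≡0 → ε≢0 (trans (sym μd≡ε) μd≡0)

¬squareFree⇒1< : ∀ {n} → 1 ≤ n → ¬ SquareFree n → 1 < n
¬squareFree⇒1< 1≤n ¬sf with ℕ.m≤n⇒m<n∨m≡n 1≤n
... | inj₁ 1<n  = 1<n
... | inj₂ refl = contradiction squareFree[1] ¬sf

-- Toggling a prime factor

toggle : ℕ → ℕ → ℕ
toggle r d with r ∣? d
... | yes _ = d ÷ r
... | no  _ = d * r

toggle-∤ : ∀ {r e} → ¬ r ∣ e → toggle r e ≡ e * r
toggle-∤ {r} {e} r∤e with r ∣? e
... | yes r∣e = contradiction r∣e r∤e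
... | no  _   = refl

toggle-* : ∀ {r e} .{{_ : NonZero r}} → toggle r (e * r) ≡ e
toggle-* {r} {e} with r ∣? e * r
... | yes _   = trans (cong (_÷ r) (ℕ.*-comm e r)) (*-÷-cancelˡ e r)
... | no  r∤d = contradiction (ℕ∣.n∣m*n e) r∤d

record TogglePair (r d : ℕ) : Set where
  field
    base   : ℕ
    r∤base : ¬ r ∣ base
    cases  : (d ≡ base × toggle r d ≡ base * r) ⊎ (d ≡ base * r × toggle r d ≡ base)

togglePair : ∀ {r d} → Prime r → SquareFree d → TogglePair r d
togglePair {r} {d} r-prime sf with r ∣? d
... | no  r∤d = record { base = d ; r∤base = r∤d ; cases = inj₁ (refl , toggle-∤ r∤d) }
... | yes r∣d = record
  { base   = d ÷ r
  ; r∤base = squareFree⇒∤÷ sf r-prime r∣d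
  ; cases  = inj₂ (d≡[d÷r]*r , trans (cong (toggle r) d≡[d÷r]*r) toggle-*) }
  where
  instance
    r≢0 : NonZero r
    r≢0 = prime⇒nonZero r-prime
  d≡[d÷r]*r : d ≡ (d ÷ r) * r
  d≡[d÷r]*r = trans (sym (*-÷-cancel r∣d)) (ℕ.*-comm r _)

module _ {r d : ℕ} (r-prime : Prime r) (sf : SquareFree d) where
  private instance
    r≢0 : NonZero r
    r≢0 = prime⇒nonZero r-prime

  toggle-involutive : toggle r (toggle r d) ≡ d
  toggle-involutive with togglePair r-prime sf
  ... | record { r∤base = r∤e ; cases = inj₁ (refl , t≡er) } = trans (cong (toggle r) t≡er) toggle-*
  ... | record { r∤base = r∤e ; cases = inj₂ (refl , t≡e) }  = trans (cong (toggle r) t≡e) (toggle-∤ r∤e)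

  toggle-squareFree : SquareFree (toggle r d)
  toggle-squareFree with togglePair r-prime sf
  ... | record { r∤base = r∤e ; cases = inj₁ (refl , t≡er) } = subst SquareFree (sym t≡er) (squareFree-* sf r-prime r∤e)
  ... | record { r∤base = r∤e ; cases = inj₂ (refl , t≡e) }  = subst SquareFree (sym t≡e) (squareFree-∣ sf (ℕ∣.m∣m*n r))

  μ-toggle : μ (toggle r d) ≡ ℤ.- μ d
  μ-toggle with togglePair r-prime sf
  ... | record { r∤base = r∤e ; cases = inj₁ (refl , t≡er) } = trans (cong μ t≡er) (μ-* sf r-prime r∤e)
  ... | record { r∤base = r∤e ; cases = inj₂ (refl , t≡e) }  =
    trans (cong μ t≡e) (trans (sym (ℤ.neg-involutive _)) (cong ℤ.-_ (sym (μ-* (squareFree-∣ sf (ℕ∣.m∣m*n r)) r-prime r∤e))))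

  toggle-∣ : ∀ {n} → r ∣ n → d ∣ n → toggle r d ∣ n
  toggle-∣ r∣n d∣n with togglePair r-prime sf
  ... | record { r∤base = r∤e ; cases = inj₁ (refl , t≡er) } = subst (_∣ _) (sym t≡er) (∣∧prime∣⇒*∣ d∣n r-prime r∣n r∤e)
  ... | record { r∤base = r∤e ; cases = inj₂ (refl , t≡e) }  = subst (_∣ _) (sym t≡e) (∣-trans (ℕ∣.m∣m*n r) d∣n)

-- The ring ℤ[q]

infix 4 _≋_

-- _≈P_ is a function type, from which Agda cannot infer the two polynomials; the record
-- makes them inferable.
record _≋_ (a b : Poly) : Set where
  constructor coeffwise
  field coeff-≡ : a ≈P b
open _≋_ public

≋-refl : ∀ {a} → a ≋ a
≋-refl = coeffwise λ _ → refl

≋-sym : ∀ {a b} → a ≋ b → b ≋ a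
≋-sym (coeffwise e) = coeffwise λ i → sym (e i)

≋-trans : ∀ {a b c} → a ≋ b → b ≋ c → a ≋ c
≋-trans (coeffwise e) (coeffwise f) = coeffwise λ i → trans (e i) (f i)

≋-reflexive : ∀ {a b} → a ≡ b → a ≋ b
≋-reflexive refl = ≋-refl

≋-isEquivalence : IsEquivalence _≋_
≋-isEquivalence = record { refl = ≋-refl ; sym = ≋-sym ; trans = ≋-trans }

≋-setoid : Setoid 0ℓ 0ℓ
≋-setoid = record { isEquivalence = ≋-isEquivalence }

module ≋-Reasoning = SetoidReasoning ≋-setoid

∷-cong : ∀ {x y a b} → x ≡ y → a ≋ b → x ∷ a ≋ y ∷ b
∷-cong x≡y (coeffwise e) = coeffwise λ { zero → x≡y ; (suc i) → e i }

∷-injectiveˡ : ∀ {x y a b} → x ∷ a ≋ y ∷ b → x ≡ y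
∷-injectiveˡ (coeffwise e) = e zero

∷-injectiveʳ : ∀ {x y a b} → x ∷ a ≋ y ∷ b → a ≋ b
∷-injectiveʳ (coeffwise e) = coeffwise λ i → e (suc i)

∷≋0⇒head≡0 : ∀ {x a} → x ∷ a ≋ [] → x ≡ + 0
∷≋0⇒head≡0 (coeffwise e) = e zero

∷≋0⇒tail≋0 : ∀ {x a} → x ∷ a ≋ [] → a ≋ []
∷≋0⇒tail≋0 (coeffwise e) = coeffwise λ i → e (suc i)

0∷≋0⇒≋0 : ∀ {a} → + 0 ∷ a ≋ a → a ≋ []
0∷≋0⇒≋0 {a} (coeffwise e) = coeffwise vanish
  where
  vanish : ∀ i → coeff a i ≡ + 0
  vanish zero    = sym (e zero)
  vanish (suc i) = trans (sym (e (suc i))) (vanish i)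

coeff-+P : ∀ a b i → coeff (a +P b) i ≡ coeff a i ℤ.+ coeff b i
coeff-+P []      b       i       = sym (ℤ.+-identityˡ _)
coeff-+P (x ∷ a) []      i       = sym (ℤ.+-identityʳ _)
coeff-+P (x ∷ a) (y ∷ b) zero    = refl
coeff-+P (x ∷ a) (y ∷ b) (suc i) = coeff-+P a b i

coeff-scaleP : ∀ c a i → coeff (scaleP c a) i ≡ c ℤ.* coeff a i
coeff-scaleP c []      i       = sym (ℤ.*-zeroʳ c)
coeff-scaleP c (x ∷ a) zero    = refl
coeff-scaleP c (x ∷ a) (suc i) = coeff-scaleP c a i

coeff-negP : ∀ a i → coeff (-P a) i ≡ ℤ.- coeff a i
coeff-negP []      i       = refl
coeff-negP (x ∷ a) zero    = refl
coeff-negP (x ∷ a) (suc i) = coeff-negP a i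

+P-cong : ∀ {a a′ b b′} → a ≋ a′ → b ≋ b′ → a +P b ≋ a′ +P b′
+P-cong {a} {a′} {b} {b′} (coeffwise e) (coeffwise f) = coeffwise λ i →
  trans (coeff-+P a b i) (trans (cong₂ ℤ._+_ (e i) (f i)) (sym (coeff-+P a′ b′ i)))

-P-cong : ∀ {a b} → a ≋ b → -P a ≋ -P b
-P-cong {a} {b} (coeffwise e) = coeffwise λ i →
  trans (coeff-negP a i) (trans (cong ℤ.-_ (e i)) (sym (coeff-negP b i)))

scaleP-cong : ∀ c {a b} → a ≋ b → scaleP c a ≋ scaleP c b
scaleP-cong c {a} {b} (coeffwise e) = coeffwise λ i →
  trans (coeff-scaleP c a i) (trans (cong (c ℤ.*_) (e i)) (sym (coeff-scaleP c b i)))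

+P-assoc : ∀ a b c → (a +P b) +P c ≋ a +P (b +P c)
+P-assoc a b c = coeffwise λ i → begin
  coeff ((a +P b) +P c) i                  ≡⟨ trans (coeff-+P (a +P b) c i) (cong (ℤ._+ coeff c i) (coeff-+P a b i)) ⟩
  coeff a i ℤ.+ coeff b i ℤ.+ coeff c i    ≡⟨ ℤ.+-assoc (coeff a i) _ _ ⟩
  coeff a i ℤ.+ (coeff b i ℤ.+ coeff c i)  ≡⟨ sym (trans (coeff-+P a (b +P c) i) (cong (λ z → coeff a i ℤ.+ z) (coeff-+P b c i))) ⟩
  coeff (a +P (b +P c)) i                  ∎
  where open ≡-Reasoning

+P-comm : ∀ a b → a +P b ≋ b +P a
+P-comm a b = coeffwise λ i →
  trans (coeff-+P a b i) (trans (ℤ.+-comm (coeff a i) _) (sym (coeff-+P b a i)))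

+P-identityʳ : ∀ a → a +P [] ≋ a
+P-identityʳ a = coeffwise λ i → trans (coeff-+P a [] i) (ℤ.+-identityʳ _)

-P-inverseʳ : ∀ a → a -P a ≋ []
-P-inverseʳ a = coeffwise λ i →
  trans (coeff-+P a (-P a) i) (trans (cong (λ z → coeff a i ℤ.+ z) (coeff-negP a i)) (ℤ.+-inverseʳ (coeff a i)))

-P-inverseˡ : ∀ a → (-P a) +P a ≋ []
-P-inverseˡ a = ≋-trans (+P-comm (-P a) a) (-P-inverseʳ a)

+P-interchange : ∀ a b c d → (a +P b) +P (c +P d) ≋ (a +P c) +P (b +P d)
+P-interchange a b c d = coeffwise λ i → begin
  coeff ((a +P b) +P (c +P d)) i                    ≡⟨ expand a b c d i ⟩
  (coeff a i ℤ.+ coeff b i) ℤ.+ (coeff c i ℤ.+ coeff d i) ≡⟨ swap-middle (coeff a i) (coeff b i) (coeff c i) (coeff d i) ⟩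
  (coeff a i ℤ.+ coeff c i) ℤ.+ (coeff b i ℤ.+ coeff d i) ≡⟨ sym (expand a c b d i) ⟩
  coeff ((a +P c) +P (b +P d)) i                    ∎
  where
  open ≡-Reasoning
  expand : ∀ a b c d i → coeff ((a +P b) +P (c +P d)) i ≡ (coeff a i ℤ.+ coeff b i) ℤ.+ (coeff c i ℤ.+ coeff d i)
  expand a b c d i = trans (coeff-+P (a +P b) (c +P d) i) (cong₂ ℤ._+_ (coeff-+P a b i) (coeff-+P c d i))
  swap-middle : ∀ w x y z → (w ℤ.+ x) ℤ.+ (y ℤ.+ z) ≡ (w ℤ.+ y) ℤ.+ (x ℤ.+ z)
  swap-middle = ℤ-Solver.solve-∀

scaleP-distribˡ : ∀ c a b → scaleP c (a +P b) ≋ scaleP c a +P scaleP c b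
scaleP-distribˡ c a b = coeffwise λ i → begin
  coeff (scaleP c (a +P b)) i                ≡⟨ trans (coeff-scaleP c (a +P b) i) (cong (c ℤ.*_) (coeff-+P a b i)) ⟩
  c ℤ.* (coeff a i ℤ.+ coeff b i)            ≡⟨ ℤ.*-distribˡ-+ c (coeff a i) _ ⟩
  c ℤ.* coeff a i ℤ.+ c ℤ.* coeff b i        ≡⟨ sym (trans (coeff-+P (scaleP c a) _ i) (cong₂ ℤ._+_ (coeff-scaleP c a i) (coeff-scaleP c b i))) ⟩
  coeff (scaleP c a +P scaleP c b) i         ∎
  where open ≡-Reasoning

scaleP-distribʳ : ∀ c d a → scaleP (c ℤ.+ d) a ≋ scaleP c a +P scaleP d a
scaleP-distribʳ c d a = coeffwise λ i → begin
  coeff (scaleP (c ℤ.+ d) a) i               ≡⟨ coeff-scaleP (c ℤ.+ d) a i ⟩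
  (c ℤ.+ d) ℤ.* coeff a i                    ≡⟨ ℤ.*-distribʳ-+ (coeff a i) c d ⟩
  c ℤ.* coeff a i ℤ.+ d ℤ.* coeff a i        ≡⟨ sym (trans (coeff-+P (scaleP c a) _ i) (cong₂ ℤ._+_ (coeff-scaleP c a i) (coeff-scaleP d a i))) ⟩
  coeff (scaleP c a +P scaleP d a) i         ∎
  where open ≡-Reasoning

scaleP-assoc : ∀ c d a → scaleP (c ℤ.* d) a ≋ scaleP c (scaleP d a)
scaleP-assoc c d a = coeffwise λ i →
  trans (coeff-scaleP (c ℤ.* d) a i) (trans (ℤ.*-assoc c d _)
    (sym (trans (coeff-scaleP c (scaleP d a) i) (cong (c ℤ.*_) (coeff-scaleP d a i)))))

scaleP-zero : ∀ a → scaleP (+ 0) a ≋ []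
scaleP-zero a = coeffwise λ i → trans (coeff-scaleP (+ 0) a i) (ℤ.*-zeroˡ (coeff a i))

scaleP-one : ∀ a → scaleP (+ 1) a ≋ a
scaleP-one a = coeffwise λ i → trans (coeff-scaleP (+ 1) a i) (ℤ.*-identityˡ (coeff a i))

-P≋scaleP-1 : ∀ a → -P a ≋ scaleP -[1+ 0 ] a
-P≋scaleP-1 a = coeffwise λ i →
  trans (coeff-negP a i) (trans (sym (ℤ.-1*i≡-i (coeff a i))) (sym (coeff-scaleP -[1+ 0 ] a i)))

scaleP-neg : ∀ c a → scaleP (ℤ.- c) a ≋ -P scaleP c a
scaleP-neg c a = coeffwise λ i → trans (coeff-scaleP (ℤ.- c) a i)
  (trans (sym (ℤ.neg-distribˡ-* c (coeff a i))) (sym (trans (coeff-negP (scaleP c a) i) (cong ℤ.-_ (coeff-scaleP c a i)))))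

≋-P⇒≋0 : ∀ {a} → a ≋ -P a → a ≋ []
≋-P⇒≋0 {a} (coeffwise e) = coeffwise λ i → self-negative (trans (e i) (coeff-negP a i))
  where
  self-negative : ∀ {x} → x ≡ ℤ.- x → x ≡ + 0
  self-negative {+_ zero}    _  = refl
  self-negative {+_ (suc _)} ()
  self-negative { -[1+ _ ]}  ()

*P-zeroʳ : ∀ a → a *P [] ≋ []
*P-zeroʳ []      = ≋-refl
*P-zeroʳ (x ∷ a) = coeffwise λ { zero → refl ; (suc i) → coeff-≡ (*P-zeroʳ a) i }

≋0⇒*P≋0 : ∀ {a} b → a ≋ [] → a *P b ≋ []
≋0⇒*P≋0 {[]}    b a≋0 = ≋-refl
≋0⇒*P≋0 {x ∷ a} b a≋0 = begin
  scaleP x b +P (+ 0 ∷ a *P b)   ≈⟨ +P-cong (≋-trans (≋-reflexive (cong (λ c → scaleP c b) (∷≋0⇒head≡0 a≋0))) (scaleP-zero b))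
                                            (∷-cong refl (≋0⇒*P≋0 b (∷≋0⇒tail≋0 a≋0))) ⟩
  [] +P (+ 0 ∷ [])               ≈⟨ coeffwise (λ { zero → refl ; (suc i) → refl }) ⟩
  []                             ∎
  where open ≋-Reasoning

*P-congˡ : ∀ {a a′} b → a ≋ a′ → a *P b ≋ a′ *P b
*P-congˡ {[]}    {a′}     b e = ≋-sym (≋0⇒*P≋0 b (≋-sym e))
*P-congˡ {x ∷ a} {[]}     b e = ≋0⇒*P≋0 b e
*P-congˡ {x ∷ a} {y ∷ a′} b e = +P-cong (≋-reflexive (cong (λ c → scaleP c b) (∷-injectiveˡ e)))
                                         (∷-cong refl (*P-congˡ b (∷-injectiveʳ e)))

*P-congʳ : ∀ a {b b′} → b ≋ b′ → a *P b ≋ a *P b′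
*P-congʳ []      e = ≋-refl
*P-congʳ (x ∷ a) e = +P-cong (scaleP-cong x e) (∷-cong refl (*P-congʳ a e))

*P-cong : ∀ {a a′ b b′} → a ≋ a′ → b ≋ b′ → a *P b ≋ a′ *P b′
*P-cong {a′ = a′} {b = b} e f = ≋-trans (*P-congˡ b e) (*P-congʳ a′ f)

*P-distribʳ : ∀ c a b → (a +P b) *P c ≋ (a *P c) +P (b *P c)
*P-distribʳ c []      b       = ≋-refl
*P-distribʳ c (x ∷ a) []      = ≋-sym (+P-identityʳ _)
*P-distribʳ c (x ∷ a) (y ∷ b) = begin
  scaleP (x ℤ.+ y) c +P (+ 0 ∷ (a +P b) *P c)
    ≈⟨ +P-cong (scaleP-distribʳ x y c) (∷-cong (sym (ℤ.+-identityʳ (+ 0))) (*P-distribʳ c a b)) ⟩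
  (scaleP x c +P scaleP y c) +P ((+ 0 ∷ a *P c) +P (+ 0 ∷ b *P c))
    ≈⟨ +P-interchange (scaleP x c) (scaleP y c) _ _ ⟩
  (scaleP x c +P (+ 0 ∷ a *P c)) +P (scaleP y c +P (+ 0 ∷ b *P c)) ∎
  where open ≋-Reasoning

scaleP-*Pˡ : ∀ c a b → scaleP c a *P b ≋ scaleP c (a *P b)
scaleP-*Pˡ c []      b = ≋-refl
scaleP-*Pˡ c (x ∷ a) b = begin
  scaleP (c ℤ.* x) b +P (+ 0 ∷ scaleP c a *P b)        ≈⟨ +P-cong (scaleP-assoc c x b) (∷-cong (sym (ℤ.*-zeroʳ c)) (scaleP-*Pˡ c a b)) ⟩
  scaleP c (scaleP x b) +P scaleP c (+ 0 ∷ a *P b)     ≈⟨ ≋-sym (scaleP-distribˡ c (scaleP x b) _) ⟩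
  scaleP c (scaleP x b +P (+ 0 ∷ a *P b))              ∎
  where open ≋-Reasoning

*P-assoc : ∀ a b c → (a *P b) *P c ≋ a *P (b *P c)
*P-assoc []      b c = ≋-refl
*P-assoc (x ∷ a) b c = begin
  (scaleP x b +P (+ 0 ∷ a *P b)) *P c               ≈⟨ *P-distribʳ c (scaleP x b) _ ⟩
  scaleP x b *P c +P (+ 0 ∷ a *P b) *P c            ≈⟨ +P-cong (scaleP-*Pˡ x b c) (+P-cong (scaleP-zero c) (∷-cong refl (*P-assoc a b c))) ⟩
  scaleP x (b *P c) +P (+ 0 ∷ a *P (b *P c))        ∎
  where open ≋-Reasoning

*P-∷ʳ : ∀ a y b → a *P (y ∷ b) ≋ scaleP y a +P (+ 0 ∷ a *P b)
*P-∷ʳ []      y b = coeffwise λ { zero → refl ; (suc i) → refl }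
*P-∷ʳ (x ∷ a) y b = ∷-cong (trans (ℤ.+-identityʳ _) (trans (ℤ.*-comm x y) (sym (ℤ.+-identityʳ _)))) (begin
  scaleP x b +P a *P (y ∷ b)                        ≈⟨ +P-cong ≋-refl (*P-∷ʳ a y b) ⟩
  scaleP x b +P (scaleP y a +P (+ 0 ∷ a *P b))      ≈⟨ ≋-sym (+P-assoc (scaleP x b) _ _) ⟩
  (scaleP x b +P scaleP y a) +P (+ 0 ∷ a *P b)      ≈⟨ +P-cong (+P-comm (scaleP x b) _) ≋-refl ⟩
  (scaleP y a +P scaleP x b) +P (+ 0 ∷ a *P b)      ≈⟨ +P-assoc (scaleP y a) _ _ ⟩
  scaleP y a +P (scaleP x b +P (+ 0 ∷ a *P b))      ∎)
  where open ≋-Reasoning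

*P-comm : ∀ a b → a *P b ≋ b *P a
*P-comm []      b = ≋-sym (*P-zeroʳ b)
*P-comm (x ∷ a) b = ≋-trans (+P-cong ≋-refl (∷-cong refl (*P-comm a b))) (≋-sym (*P-∷ʳ b x a))

*P-identityˡ : ∀ a → oneP *P a ≋ a
*P-identityˡ a = ≋-trans (+P-cong (scaleP-one a) (coeffwise λ { zero → refl ; (suc i) → refl })) (+P-identityʳ a)

*P-identityʳ : ∀ a → a *P oneP ≋ a
*P-identityʳ a = ≋-trans (*P-comm a oneP) (*P-identityˡ a)

*P-distribˡ : ∀ a b c → a *P (b +P c) ≋ (a *P b) +P (a *P c)
*P-distribˡ a b c = begin
  a *P (b +P c)          ≈⟨ *P-comm a _ ⟩
  (b +P c) *P a          ≈⟨ *P-distribʳ a b c ⟩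
  b *P a +P c *P a       ≈⟨ +P-cong (*P-comm b a) (*P-comm c a) ⟩
  a *P b +P a *P c       ∎
  where open ≋-Reasoning

ℤ[q] : CommutativeRing 0ℓ 0ℓ
ℤ[q] = record
  { Carrier = Poly ; _≈_ = _≋_ ; _+_ = _+P_ ; _*_ = _*P_ ; -_ = -P_ ; 0# = zeroP ; 1# = oneP
  ; isCommutativeRing = record
    { isRing = record
      { +-isAbelianGroup = record
        { isGroup = record
          { isMonoid = record
            { isSemigroup = record { isMagma = record { isEquivalence = ≋-isEquivalence ; ∙-cong = +P-cong } ; assoc = +P-assoc }
            ; identity = (λ _ → ≋-refl) , +P-identityʳ }
          ; inverse = -P-inverseˡ , -P-inverseʳ
          ; ⁻¹-cong = -P-cong }
        ; comm = +P-comm }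
      ; *-cong = *P-cong ; *-assoc = *P-assoc ; *-identity = *P-identityˡ , *P-identityʳ
      ; distrib = *P-distribˡ , (λ c a b → *P-distribʳ c a b) }
    ; *-comm = *P-comm } }

open CommutativeRing ℤ[q] using (+-group; +-abelianGroup; +-commutativeMonoid; *-monoid; *-commutativeMonoid; *-commutativeSemigroup; ring)
open import Algebra.Properties.AbelianGroup +-abelianGroup using (xyx⁻¹≈y; ⁻¹-∙-comm)
open import Algebra.Properties.CommutativeSemigroup *-commutativeSemigroup using (x∙yz≈y∙xz; xy∙z≈y∙xz)
open import Algebra.Properties.CommutativeSemigroup.Divisibility *-commutativeSemigroup
  using (_,_; ∣ʳ-trans; ∣ʳ-respʳ-≈; ∣ʳ-respˡ-≈; x∣ʳy⇒x∣ʳzy; ∙-cong-∣; xy≈z⇒x∣z) renaming (_∣_ to _∣P_)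
open import Algebra.Properties.Group +-group using (x∙y⁻¹≈ε⇒x≈y)
open import Algebra.Properties.Monoid.Divisibility *-monoid using (∣ʳ-refl; ε∣ʳ_)
open import Algebra.Properties.Ring ring using (x[y-z]≈xy-xz; -‿distribˡ-*)

∣-+P : ∀ {a b c} → a ∣P b → a ∣P c → a ∣P b +P c
∣-+P {a} (h , ha≋b) (k , ka≋c) = h +P k , ≋-trans (*P-distribʳ a h k) (+P-cong ha≋b ka≋c)

∣-minusP : ∀ {a b c} → a ∣P b → a ∣P c → a ∣P b -P c
∣-minusP {a} a∣b (k , ka≋c) = ∣-+P a∣b (-P k , ≋-trans (≋-sym (-‿distribˡ-* k a)) (-P-cong ka≋c))

∣⇒≡P[mod] : ∀ a b {m} → m ∣P a -P b → a ≡P b [mod m ]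
∣⇒≡P[mod] _ _ (h , hm≋a-b) = h , coeff-≡ (≋-sym hm≋a-b)

-- Substitution q ↦ q^d

shift : ℕ → Poly → Poly
shift k a = replicate k (+ 0) ++ a

shift-cong : ∀ k {a b} → a ≋ b → shift k a ≋ shift k b
shift-cong zero    e = e
shift-cong (suc k) e = ∷-cong refl (shift-cong k e)

shift-+ : ∀ j k a → shift j (shift k a) ≡ shift (j ℕ.+ k) a
shift-+ zero    k a = refl
shift-+ (suc j) k a = cong (+ 0 ∷_) (shift-+ j k a)

shift-[] : ∀ k → shift k [] ≋ []
shift-[] zero    = ≋-refl
shift-[] (suc k) = coeffwise λ { zero → refl ; (suc i) → coeff-≡ (shift-[] k) i }

shift-+P : ∀ k a b → shift k (a +P b) ≋ shift k a +P shift k b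
shift-+P zero    a b = ≋-refl
shift-+P (suc k) a b = ∷-cong (sym (ℤ.+-identityʳ (+ 0))) (shift-+P k a b)

shift-scaleP : ∀ k c a → shift k (scaleP c a) ≋ scaleP c (shift k a)
shift-scaleP zero    c a = ≋-refl
shift-scaleP (suc k) c a = ∷-cong (sym (ℤ.*-zeroʳ c)) (shift-scaleP k c a)

shift-*P : ∀ k a b → shift k a *P b ≋ shift k (a *P b)
shift-*P zero    a b = ≋-refl
shift-*P (suc k) a b = +P-cong (scaleP-zero b) (∷-cong refl (shift-*P k a b))

infixl 8 _⟨q^_⟩

-- a ⟨q^ d ⟩ is a(q^d) for d ≥ 1; for d = 0 it is a again, not a(1).
_⟨q^_⟩ : Poly → ℕ → Poly
[]      ⟨q^ d ⟩ = []
(c ∷ a) ⟨q^ d ⟩ = c ∷ shift (d ∸ 1) (a ⟨q^ d ⟩)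

substPow≋⟨q^⟩ : ∀ d a → substPow d a ≋ a ⟨q^ d ⟩
substPow≋⟨q^⟩ d []            = ≋-refl
substPow≋⟨q^⟩ d (c ∷ [])      = ∷-cong refl (≋-sym (shift-[] (d ∸ 1)))
substPow≋⟨q^⟩ d (c ∷ c′ ∷ cs) = ∷-cong refl (shift-cong (d ∸ 1) (substPow≋⟨q^⟩ d (c′ ∷ cs)))

≋0⇒⟨q^⟩≋0 : ∀ d {a} → a ≋ [] → a ⟨q^ d ⟩ ≋ []
≋0⇒⟨q^⟩≋0 d {[]}    _   = ≋-refl
≋0⇒⟨q^⟩≋0 d {x ∷ a} a≋0 = coeffwise λ
  { zero    → ∷≋0⇒head≡0 a≋0
  ; (suc i) → coeff-≡ (≋-trans (shift-cong (d ∸ 1) (≋0⇒⟨q^⟩≋0 d (∷≋0⇒tail≋0 a≋0))) (shift-[] (d ∸ 1))) i }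

⟨q^⟩-cong : ∀ d {a b} → a ≋ b → a ⟨q^ d ⟩ ≋ b ⟨q^ d ⟩
⟨q^⟩-cong d {[]}    {b}     e = ≋-sym (≋0⇒⟨q^⟩≋0 d (≋-sym e))
⟨q^⟩-cong d {x ∷ a} {[]}    e = ≋0⇒⟨q^⟩≋0 d e
⟨q^⟩-cong d {x ∷ a} {y ∷ b} e = ∷-cong (∷-injectiveˡ e) (shift-cong (d ∸ 1) (⟨q^⟩-cong d (∷-injectiveʳ e)))

⟨q^⟩-+P : ∀ d a b → (a +P b) ⟨q^ d ⟩ ≋ a ⟨q^ d ⟩ +P b ⟨q^ d ⟩
⟨q^⟩-+P d []      b       = ≋-refl
⟨q^⟩-+P d (x ∷ a) []      = ≋-sym (+P-identityʳ _)
⟨q^⟩-+P d (x ∷ a) (y ∷ b) = ∷-cong refl (≋-trans (shift-cong (d ∸ 1) (⟨q^⟩-+P d a b)) (shift-+P (d ∸ 1) _ _))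

⟨q^⟩-scaleP : ∀ d c a → (scaleP c a) ⟨q^ d ⟩ ≋ scaleP c (a ⟨q^ d ⟩)
⟨q^⟩-scaleP d c []      = ≋-refl
⟨q^⟩-scaleP d c (x ∷ a) = ∷-cong refl (≋-trans (shift-cong (d ∸ 1) (⟨q^⟩-scaleP d c a)) (shift-scaleP (d ∸ 1) c _))

⟨q^⟩-*P : ∀ d .{{_ : NonZero d}} a b → (a *P b) ⟨q^ d ⟩ ≋ a ⟨q^ d ⟩ *P b ⟨q^ d ⟩
⟨q^⟩-*P d@(suc d-1) []      b = ≋-refl
⟨q^⟩-*P d@(suc d-1) (x ∷ a) b = begin
  (scaleP x b +P (+ 0 ∷ a *P b)) ⟨q^ d ⟩                        ≈⟨ ⟨q^⟩-+P d (scaleP x b) _ ⟩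
  (scaleP x b) ⟨q^ d ⟩ +P (+ 0 ∷ shift d-1 ((a *P b) ⟨q^ d ⟩))  ≈⟨ +P-cong (⟨q^⟩-scaleP d x b) (∷-cong refl (shift-cong d-1 (⟨q^⟩-*P d a b))) ⟩
  scaleP x (b ⟨q^ d ⟩) +P (+ 0 ∷ shift d-1 (a ⟨q^ d ⟩ *P b ⟨q^ d ⟩)) ≈⟨ +P-cong ≋-refl (∷-cong refl (≋-sym (shift-*P d-1 _ _))) ⟩
  scaleP x (b ⟨q^ d ⟩) +P (+ 0 ∷ shift d-1 (a ⟨q^ d ⟩) *P b ⟨q^ d ⟩) ∎
  where open ≋-Reasoning

⟨q^⟩-shift : ∀ d .{{_ : NonZero d}} k a → (shift k a) ⟨q^ d ⟩ ≋ shift (d ℕ.* k) (a ⟨q^ d ⟩)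
⟨q^⟩-shift d zero    a = ≋-reflexive (cong (λ j → shift j (a ⟨q^ d ⟩)) (sym (ℕ.*-zeroʳ d)))
⟨q^⟩-shift d@(suc d-1) (suc k) a = begin
  shift d ((shift k a) ⟨q^ d ⟩)            ≈⟨ shift-cong d (⟨q^⟩-shift d k a) ⟩
  shift d (shift (d ℕ.* k) (a ⟨q^ d ⟩))    ≈⟨ ≋-reflexive (trans (shift-+ d _ _) (cong (λ j → shift j (a ⟨q^ d ⟩)) (sym (ℕ.*-suc d k)))) ⟩
  shift (d ℕ.* suc k) (a ⟨q^ d ⟩)          ∎
  where open ≋-Reasoning

⟨q^⟩-⟨q^⟩ : ∀ d e .{{_ : NonZero d}} .{{_ : NonZero e}} a → a ⟨q^ e ⟩ ⟨q^ d ⟩ ≋ a ⟨q^ d ℕ.* e ⟩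
⟨q^⟩-⟨q^⟩ d e []      = ≋-refl
⟨q^⟩-⟨q^⟩ d@(suc d-1) e@(suc e-1) (c ∷ a) = ∷-cong refl (begin
  shift d-1 ((shift e-1 (a ⟨q^ e ⟩)) ⟨q^ d ⟩)             ≈⟨ shift-cong d-1 (⟨q^⟩-shift d e-1 _) ⟩
  shift d-1 (shift (d ℕ.* e-1) (a ⟨q^ e ⟩ ⟨q^ d ⟩))        ≈⟨ shift-cong d-1 (shift-cong (d ℕ.* e-1) (⟨q^⟩-⟨q^⟩ d e a)) ⟩
  shift d-1 (shift (d ℕ.* e-1) (a ⟨q^ d ℕ.* e ⟩))          ≈⟨ ≋-reflexive (trans (shift-+ d-1 _ _) (cong (λ j → shift j (a ⟨q^ d ℕ.* e ⟩)) (exponent d-1 e-1))) ⟩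
  shift (d ℕ.* e ∸ 1) (a ⟨q^ d ℕ.* e ⟩)                   ∎)
  where
  open ≋-Reasoning
  exponent : ∀ m n → m ℕ.+ suc m ℕ.* n ≡ n ℕ.+ m ℕ.* suc n
  exponent = ℕ-Solver.solve-∀

oneP⟨q^⟩ : ∀ d → oneP ⟨q^ d ⟩ ≋ oneP
oneP⟨q^⟩ d = ∷-cong refl (shift-[] (d ℕ.∸ 1))

⟨q^⟩-∣ : ∀ d .{{_ : NonZero d}} {a b} → a ∣P b → a ⟨q^ d ⟩ ∣P b ⟨q^ d ⟩
⟨q^⟩-∣ d {a} (h , ha≋b) = h ⟨q^ d ⟩ , ≋-trans (≋-sym (⟨q^⟩-*P d h a)) (⟨q^⟩-cong d ha≋b)

-- q-integers

qPowMinus1≋qMinus1⟨q^⟩ : ∀ k → qPowMinus1 (suc k) ≋ qMinus1 ⟨q^ suc k ⟩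
qPowMinus1≋qMinus1⟨q^⟩ k = ∷-cong refl (shift-cong k (∷-cong refl (≋-sym (shift-[] k))))

qPowMinus1-suc : ∀ k → qPowMinus1 (suc k) ≋ (+ 0 ∷ qPowMinus1 k) +P qMinus1
qPowMinus1-suc zero    = ≋-refl
qPowMinus1-suc (suc k) = coeffwise λ
  { zero → refl ; (suc zero) → refl
  ; (suc (suc i)) → sym (trans (coeff-+P (shift k (+ 1 ∷ [])) [] i) (ℤ.+-identityʳ _)) }

qMinus1*qInt : ∀ n → qMinus1 *P qInt n ≋ qPowMinus1 n
qMinus1*qInt zero    = *P-zeroʳ qMinus1
qMinus1*qInt (suc n) = begin
  qMinus1 *P qInt (suc n)                  ≈⟨ *P-comm qMinus1 (qInt (suc n)) ⟩
  scaleP (+ 1) qMinus1 +P (+ 0 ∷ qInt n *P qMinus1) ≈⟨ +P-cong (scaleP-one qMinus1) (∷-cong (refl {x = + 0}) (≋-trans (*P-comm (qInt n) _) (qMinus1*qInt n))) ⟩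
  qMinus1 +P (+ 0 ∷ qPowMinus1 n)          ≈⟨ +P-comm qMinus1 (+ 0 ∷ qPowMinus1 n) ⟩
  (+ 0 ∷ qPowMinus1 n) +P qMinus1          ≈⟨ ≋-sym (qPowMinus1-suc n) ⟩
  qPowMinus1 (suc n)                       ∎
  where open ≋-Reasoning

qPowMinus1-* : ∀ a .{{_ : NonZero a}} b → qPowMinus1 (a ℕ.* b) ≋ qPowMinus1 a *P qInt b ⟨q^ a ⟩
qPowMinus1-* a@(suc a-1) b = ≋-sym (begin
  qPowMinus1 a *P qInt b ⟨q^ a ⟩           ≈⟨ *P-congˡ _ (qPowMinus1≋qMinus1⟨q^⟩ a-1) ⟩
  qMinus1 ⟨q^ a ⟩ *P qInt b ⟨q^ a ⟩        ≈⟨ ≋-sym (⟨q^⟩-*P a qMinus1 (qInt b)) ⟩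
  (qMinus1 *P qInt b) ⟨q^ a ⟩              ≈⟨ ⟨q^⟩-cong a (qMinus1*qInt b) ⟩
  qPowMinus1 b ⟨q^ a ⟩                     ≈⟨ qPowMinus1⟨q^⟩ b ⟩
  qPowMinus1 (a ℕ.* b)                     ∎)
  where
  open ≋-Reasoning
  qPowMinus1⟨q^⟩ : ∀ b → qPowMinus1 b ⟨q^ a ⟩ ≋ qPowMinus1 (a ℕ.* b)
  qPowMinus1⟨q^⟩ zero    = ≋-reflexive (cong qPowMinus1 (sym (ℕ.*-zeroʳ a)))
  qPowMinus1⟨q^⟩ (suc b) = begin
    qPowMinus1 (suc b) ⟨q^ a ⟩             ≈⟨ ⟨q^⟩-cong a (qPowMinus1≋qMinus1⟨q^⟩ b) ⟩
    qMinus1 ⟨q^ suc b ⟩ ⟨q^ a ⟩            ≈⟨ ⟨q^⟩-⟨q^⟩ a (suc b) qMinus1 ⟩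
    qMinus1 ⟨q^ a ℕ.* suc b ⟩              ≈⟨ ≋-sym (qPowMinus1≋qMinus1⟨q^⟩ _) ⟩
    qPowMinus1 (a ℕ.* suc b)               ∎

qMinus1*P : ∀ c → qMinus1 *P c ≋ (+ 0 ∷ c) -P c
qMinus1*P c = begin
  scaleP -[1+ 0 ] c +P (+ 0 ∷ oneP *P c)   ≈⟨ +P-cong (≋-sym (-P≋scaleP-1 c)) (∷-cong refl (*P-identityˡ c)) ⟩
  -P c +P (+ 0 ∷ c)                        ≈⟨ +P-comm (-P c) _ ⟩
  (+ 0 ∷ c) -P c                           ∎
  where open ≋-Reasoning

qMinus1-cancel : ∀ {a b} → qMinus1 *P a ≋ qMinus1 *P b → a ≋ b
qMinus1-cancel {a} {b} e = x∙y⁻¹≈ε⇒x≈y a b (0∷≋0⇒≋0 (x∙y⁻¹≈ε⇒x≈y _ _ (begin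
  (+ 0 ∷ (a -P b)) -P (a -P b)             ≈⟨ ≋-sym (qMinus1*P (a -P b)) ⟩
  qMinus1 *P (a -P b)                      ≈⟨ x[y-z]≈xy-xz qMinus1 a b ⟩
  qMinus1 *P a -P qMinus1 *P b             ≈⟨ +P-cong e ≋-refl ⟩
  qMinus1 *P b -P qMinus1 *P b             ≈⟨ -P-inverseʳ (qMinus1 *P b) ⟩
  []                                       ∎)))
  where open ≋-Reasoning

qInt-* : ∀ a .{{_ : NonZero a}} b → qInt (a ℕ.* b) ≋ qInt a *P qInt b ⟨q^ a ⟩
qInt-* a b = qMinus1-cancel (begin
  qMinus1 *P qInt (a ℕ.* b)                ≈⟨ qMinus1*qInt (a ℕ.* b) ⟩
  qPowMinus1 (a ℕ.* b)                     ≈⟨ qPowMinus1-* a b ⟩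
  qPowMinus1 a *P qInt b ⟨q^ a ⟩           ≈⟨ *P-congˡ _ (≋-sym (qMinus1*qInt a)) ⟩
  (qMinus1 *P qInt a) *P qInt b ⟨q^ a ⟩    ≈⟨ *P-assoc qMinus1 (qInt a) _ ⟩
  qMinus1 *P (qInt a *P qInt b ⟨q^ a ⟩)    ∎)
  where open ≋-Reasoning

q*P : ∀ c → (+ 0 ∷ oneP) *P c ≋ + 0 ∷ c
q*P c = +P-cong (scaleP-zero c) (∷-cong refl (*P-identityˡ c))

∣-qMinus1*P : ∀ {w b} e → w ∣P qPowMinus1 (suc e) *P b → w ∣P qPowMinus1 e *P b → w ∣P qMinus1 *P b
∣-qMinus1*P {w} {b} e w∣qᵉ⁺¹-1 w∣qᵉ-1 = ∣ʳ-respʳ-≈ telescope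
  (∣-minusP w∣qᵉ⁺¹-1 (∣ʳ-respʳ-≈ (≋-trans (q*P _) (≋-sym (shift-*P 1 (qPowMinus1 e) b))) (x∣ʳy⇒x∣ʳzy (+ 0 ∷ oneP) w∣qᵉ-1)))
  where
  open ≋-Reasoning
  telescope : qPowMinus1 (suc e) *P b -P (+ 0 ∷ qPowMinus1 e) *P b ≋ qMinus1 *P b
  telescope = begin
    qPowMinus1 (suc e) *P b -P (+ 0 ∷ qPowMinus1 e) *P b                        ≈⟨ +P-cong (*P-congˡ b (qPowMinus1-suc e)) ≋-refl ⟩
    ((+ 0 ∷ qPowMinus1 e) +P qMinus1) *P b -P (+ 0 ∷ qPowMinus1 e) *P b         ≈⟨ +P-cong (*P-distribʳ b (+ 0 ∷ qPowMinus1 e) qMinus1) ≋-refl ⟩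
    (+ 0 ∷ qPowMinus1 e) *P b +P qMinus1 *P b -P (+ 0 ∷ qPowMinus1 e) *P b       ≈⟨ xyx⁻¹≈y ((+ 0 ∷ qPowMinus1 e) *P b) (qMinus1 *P b) ⟩
    qMinus1 *P b                                                                ∎

-- With x p = 1 + y m (Bézout, either way round), q^p - 1 divides both (q^{xp} - 1)[p]_{q^m}
-- and (q^{ym} - 1)[p]_{q^m}, hence (q - 1)[p]_{q^m}.
qInt∣qInt⟨q^⟩ : ∀ p m .{{_ : NonZero p}} .{{_ : NonZero m}} → Coprime p m → qInt p ∣P qInt p ⟨q^ m ⟩
qInt∣qInt⟨q^⟩ p m coprime = cancel (from-Bézout (coprime-Bézout coprime))
  where
  open ≋-Reasoning
  B : Poly
  B = qInt p ⟨q^ m ⟩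
  W∣ᵖ : ∀ u c → qPowMinus1 p ∣P qPowMinus1 (u ℕ.* p) *P c
  W∣ᵖ u c = ∣ʳ-respʳ-≈ (*P-comm c (qPowMinus1 (u ℕ.* p))) (x∣ʳy⇒x∣ʳzy c W∣qᵘᵖ-1)
    where
    W∣qᵘᵖ-1 : qPowMinus1 p ∣P qPowMinus1 (u ℕ.* p)
    W∣qᵘᵖ-1 = ∣ʳ-respʳ-≈ (≋-reflexive (cong qPowMinus1 (ℕ.*-comm p u))) (xy≈z⇒x∣z _ _ (≋-sym (qPowMinus1-* p u)))
  W∣ᵐ : ∀ v → qPowMinus1 p ∣P qPowMinus1 (v ℕ.* m) *P B
  W∣ᵐ v = ∣ʳ-respʳ-≈ (≋-sym (begin
    qPowMinus1 (v ℕ.* m) *P B                    ≈⟨ *P-congˡ B (≋-trans (≋-reflexive (cong qPowMinus1 (ℕ.*-comm v m))) (qPowMinus1-* m v)) ⟩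
    (qPowMinus1 m *P qInt v ⟨q^ m ⟩) *P B        ≈⟨ xy∙z≈y∙xz (qPowMinus1 m) (qInt v ⟨q^ m ⟩) B ⟩
    qInt v ⟨q^ m ⟩ *P (qPowMinus1 m *P B)        ≈⟨ *P-congʳ (qInt v ⟨q^ m ⟩) (≋-trans (≋-sym (qPowMinus1-* m p)) (≋-reflexive (cong qPowMinus1 (ℕ.*-comm m p)))) ⟩
    qInt v ⟨q^ m ⟩ *P qPowMinus1 (p ℕ.* m)       ∎))
    (x∣ʳy⇒x∣ʳzy (qInt v ⟨q^ m ⟩) (xy≈z⇒x∣z _ _ (≋-sym (qPowMinus1-* p m))))
  W∣[q^_-1]B : ℕ → Set
  W∣[q^ e -1]B = qPowMinus1 p ∣P qPowMinus1 e *P B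
  from-Bézout : Bézout.Identity 1 p m → qPowMinus1 p ∣P qMinus1 *P B
  from-Bézout (Bézout.+- x y 1+ym≡xp) = ∣-qMinus1*P (y ℕ.* m) (subst W∣[q^_-1]B (sym 1+ym≡xp) (W∣ᵖ x B)) (W∣ᵐ y)
  from-Bézout (Bézout.-+ x y 1+xp≡ym) = ∣-qMinus1*P (x ℕ.* p) (subst W∣[q^_-1]B (sym 1+xp≡ym) (W∣ᵐ y)) (W∣ᵖ x B)
  cancel : qPowMinus1 p ∣P qMinus1 *P B → qInt p ∣P B
  cancel (h , hW≋[q-1]B) = h , qMinus1-cancel (begin
    qMinus1 *P (h *P qInt p)                 ≈⟨ x∙yz≈y∙xz qMinus1 h (qInt p) ⟩
    h *P (qMinus1 *P qInt p)                 ≈⟨ *P-congʳ h (qMinus1*qInt p) ⟩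
    h *P qPowMinus1 p                        ≈⟨ hW≋[q-1]B ⟩
    qMinus1 *P B                             ∎)

module _ (M : CommutativeMonoid 0ℓ 0ℓ) {A : Set} where
  open CommutativeMonoid M using (Carrier; _≈_; _∙_; ε; ∙-cong; ∙-congˡ; assoc; comm; setoid)
    renaming (refl to ≈-refl; trans to ≈-trans)
  open import Relation.Binary.Reasoning.Setoid setoid

  foldr-map-↭ : ∀ (f : A → Carrier) {xs ys} → xs ↭ ys → foldr _∙_ ε (map f xs) ≈ foldr _∙_ ε (map f ys)
  foldr-map-↭ f ↭.refl            = ≈-refl
  foldr-map-↭ f (↭.prep x xs↭ys)  = ∙-congˡ (foldr-map-↭ f xs↭ys)
  foldr-map-↭ f (↭.swap {xs} {ys} x y xs↭ys) = begin
    f x ∙ (f y ∙ Π xs)  ≈⟨ assoc (f x) (f y) (Π xs) ⟨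
    (f x ∙ f y) ∙ Π xs  ≈⟨ ∙-cong (comm (f x) (f y)) (foldr-map-↭ f xs↭ys) ⟩
    (f y ∙ f x) ∙ Π ys  ≈⟨ assoc (f y) (f x) (Π ys) ⟩
    f y ∙ (f x ∙ Π ys)  ∎
    where
    Π : List A → Carrier
    Π zs = foldr _∙_ ε (map f zs)
  foldr-map-↭ f (↭.trans p q)     = ≈-trans (foldr-map-↭ f p) (foldr-map-↭ f q)

  foldr-map-cong : ∀ {f g : A → Carrier} xs → (∀ {x} → x ∈ xs → f x ≈ g x) → foldr _∙_ ε (map f xs) ≈ foldr _∙_ ε (map g xs)
  foldr-map-cong []       _   = ≈-refl
  foldr-map-cong (x ∷ xs) f≈g = ∙-cong (f≈g (here refl)) (foldr-map-cong xs (f≈g ∘ there))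

productP-↭ : ∀ {A : Set} (f : A → Poly) {xs ys} → xs ↭ ys → productP (map f xs) ≋ productP (map f ys)
productP-↭ = foldr-map-↭ *-commutativeMonoid

productP-cong : ∀ {A : Set} {f g : A → Poly} xs → (∀ {x} → x ∈ xs → f x ≋ g x) → productP (map f xs) ≋ productP (map g xs)
productP-cong = foldr-map-cong *-commutativeMonoid

sumP-↭ : ∀ {A : Set} (f : A → Poly) {xs ys} → xs ↭ ys → sumP (map f xs) ≋ sumP (map f ys)
sumP-↭ = foldr-map-↭ +-commutativeMonoid

sumP-cong : ∀ {A : Set} {f g : A → Poly} xs → (∀ {x} → x ∈ xs → f x ≋ g x) → sumP (map f xs) ≋ sumP (map g xs)
sumP-cong = foldr-map-cong +-commutativeMonoid

sumP-neg : ∀ {A : Set} (f : A → Poly) xs → sumP (map (-P_ ∘ f) xs) ≋ -P sumP (map f xs)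
sumP-neg f []       = ≋-refl
sumP-neg f (x ∷ xs) = ≋-trans (+P-cong ≋-refl (sumP-neg f xs)) (⁻¹-∙-comm (f x) (sumP (map f xs)))

∈⇒∣productP : ∀ {A : Set} (f : A → Poly) {x xs} → x ∈ xs → f x ∣P productP (map f xs)
∈⇒∣productP f {xs = _ ∷ xs} (here refl) = xy≈z⇒x∣z _ (productP (map f xs)) ≋-refl
∈⇒∣productP f {xs = y ∷ _}  (there x∈)  = x∣ʳy⇒x∣ʳzy (f y) (∈⇒∣productP f x∈)

productP-filter-∣ : ∀ {A : Set} (f : A → Poly) {P : Pred A 0ℓ} (P? : Decidable P) xs → productP (map f (filter P? xs)) ∣P productP (map f xs)
productP-filter-∣ f P? []       = ∣ʳ-refl
productP-filter-∣ f P? (x ∷ xs) with P? x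
... | yes _ = ∙-cong-∣ (∣ʳ-refl {f x}) (productP-filter-∣ f P? xs)
... | no  _ = x∣ʳy⇒x∣ʳzy (f x) (productP-filter-∣ f P? xs)

unique-map : ∀ {f g : ℕ → ℕ} {xs} → (∀ {x} → x ∈ xs → g (f x) ≡ x) → Unique xs → Unique (map f xs)
unique-map {xs = []}     _   []          = []
unique-map {f} {g} {xs = x ∷ xs} gf≡id (x∉xs ∷ xs!) =
  All.map⁺ (All.tabulate λ y∈ fx≡fy → All.lookup x∉xs y∈ (trans (sym (gf≡id (here refl))) (trans (cong g fx≡fy) (gf≡id (there y∈)))))
  ∷ unique-map {f} {g} (gf≡id ∘ there) xs!

productP-⊆-∣ : ∀ (f : ℕ → Poly) {xs ys} → Unique xs → Unique ys → (∀ {x} → x ∈ xs → x ∈ ys) →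
               productP (map f xs) ∣P productP (map f ys)
productP-⊆-∣ f {xs} {ys} xs! ys! xs⊆ys = ∣ʳ-respˡ-≈ (productP-↭ f xs∩ys↭xs) (productP-filter-∣ f (_∈? xs) ys)
  where
  xs∩ys↭xs : filter (_∈? xs) ys ↭ xs
  xs∩ys↭xs = ↭-fromMembership (Unique.filter⁺ (_∈? xs) ys!) xs!
    (mk⇔ (proj₂ ∘ ∈-filter⁻ (_∈? xs) {xs = ys}) (λ x∈xs → ∈-filter⁺ (_∈? xs) (xs⊆ys x∈xs) x∈xs))

record PairedBy (ι : ℕ → ℕ) (xs ys : List ℕ) : Set where
  field
    ι-∈ʳ   : ∀ {x} → x ∈ xs → ι x ∈ ys
    ι-∈ˡ   : ∀ {y} → y ∈ ys → ι y ∈ xs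
    ιι≡idˡ : ∀ {x} → x ∈ xs → ι (ι x) ≡ x
    ιι≡idʳ : ∀ {y} → y ∈ ys → ι (ι y) ≡ y

module _ {ι : ℕ → ℕ} {xs ys : List ℕ} (xs! : Unique xs) (ys! : Unique ys) (paired : PairedBy ι xs ys) where
  open PairedBy paired

  map-↭ : map ι xs ↭ ys
  map-↭ = ↭-fromMembership (unique-map {ι} {ι} ιι≡idˡ xs!) ys! (mk⇔ to from)
    where
    to : ∀ {y} → y ∈ map ι xs → y ∈ ys
    to y∈ with ∈-map⁻ ι y∈
    ... | x , x∈ , refl = ι-∈ʳ x∈
    from : ∀ {y} → y ∈ ys → y ∈ map ι xs
    from y∈ = subst (_∈ map ι xs) (ιι≡idʳ y∈) (∈-map⁺ ι (ι-∈ˡ y∈))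

  productP-pairedBy : ∀ (f : ℕ → Poly) → (∀ {x} → x ∈ xs → f (ι x) ≋ f x) → productP (map f xs) ≋ productP (map f ys)
  productP-pairedBy f f∘ι≋f = begin
    productP (map f xs)              ≈⟨ productP-cong xs f∘ι≋f ⟨
    productP (map (f ∘ ι) xs)        ≡⟨ cong productP (map-∘ xs) ⟩
    productP (map f (map ι xs))      ≈⟨ productP-↭ f map-↭ ⟩
    productP (map f ys)              ∎
    where open ≋-Reasoning

sumP-pairedBy-≋0 : ∀ {ι : ℕ → ℕ} {xs} (w : ℕ → Poly) → Unique xs → PairedBy ι xs xs →
                   (∀ {x} → x ∈ xs → w (ι x) ≋ -P w x) → sumP (map w xs) ≋ []
sumP-pairedBy-≋0 {ι} {xs} w xs! paired w∘ι≋-w = ≋-P⇒≋0 (begin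
  sumP (map w xs)               ≈⟨ sumP-↭ w (map-↭ xs! xs! paired) ⟨
  sumP (map w (map ι xs))       ≡⟨ cong sumP (map-∘ xs) ⟨
  sumP (map (w ∘ ι) xs)         ≈⟨ sumP-cong xs w∘ι≋-w ⟩
  sumP (map (-P_ ∘ w) xs)       ≈⟨ sumP-neg w xs ⟩
  -P sumP (map w xs)            ∎)
  where open ≋-Reasoning

productP-⟨q^⟩ : ∀ d .{{_ : NonZero d}} ps → productP ps ⟨q^ d ⟩ ≋ productP (map (_⟨q^ d ⟩) ps)
productP-⟨q^⟩ d []       = oneP⟨q^⟩ d
productP-⟨q^⟩ d (p ∷ ps) = ≋-trans (⟨q^⟩-*P d p (productP ps)) (*P-congʳ (p ⟨q^ d ⟩) (productP-⟨q^⟩ d ps))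

primes-÷ : ∀ {n p ps} → SquareFree n → All (p ≢_) ps → (∀ {q} → q ∈ p ∷ ps ⇔ (Prime q × q ∣ n)) →
           ∀ {q} → q ∈ ps ⇔ (Prime q × q ∣ n ÷ p)
primes-÷ {n} {p} {ps} sf p∉ps primes = mk⇔ to from
  where
  p-prime : Prime p
  p-prime = proj₁ (Equivalence.to primes (here refl))
  p∣n : p ∣ n
  p∣n = proj₂ (Equivalence.to primes (here refl))
  instance
    p≢0 : NonZero p
    p≢0 = prime⇒nonZero p-prime
  to : ∀ {q} → q ∈ ps → Prime q × q ∣ n ÷ p
  to q∈ with Equivalence.to primes (there q∈)
  ... | q-prime , q∣n with euclidsLemma p (n ÷ p) q-prime (subst (_ ∣_) (sym (*-÷-cancel p∣n)) q∣n)
  ...   | inj₁ q∣p   = contradiction (sym (prime≡ q-prime p-prime q∣p)) (All.lookup p∉ps q∈)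
  ...   | inj₂ q∣n÷p = q-prime , q∣n÷p
  from : ∀ {q} → Prime q × q ∣ n ÷ p → q ∈ ps
  from (q-prime , q∣n÷p) with Equivalence.from primes (q-prime , ∣-trans q∣n÷p (÷-∣ p∣n))
  ... | here refl = contradiction q∣n÷p (squareFree⇒∤÷ sf p-prime p∣n)
  ... | there q∈  = q∈

qInt⟨q^÷⟩⟨q^⟩ : ∀ {m q} p .{{_ : NonZero p}} .{{_ : NonZero q}} .{{_ : NonZero (m ÷ q)}} → q ∣ m →
                qInt q ⟨q^ m ÷ q ⟩ ⟨q^ p ⟩ ≋ qInt q ⟨q^ (p * m) ÷ q ⟩
qInt⟨q^÷⟩⟨q^⟩ {m} {q} p q∣m = ≋-trans (⟨q^⟩-⟨q^⟩ p (m ÷ q) (qInt q)) (≋-reflexive (cong (qInt q ⟨q^_⟩) (sym (*-÷-assoc p q∣m))))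

-- Splitting off one prime p of n = p m gives [n] = [p] [m]_{q^p}; here [p] ∣ [p]_{q^m} as p ∤ m,
-- and [m]_{q^p} divides the remaining factors by induction.
qInt∣∏qInt⟨q^⟩ : ∀ ps {n} → SquareFree n → Unique ps → (∀ {p} → p ∈ ps ⇔ (Prime p × p ∣ n)) →
                 qInt n ∣P productP (map (λ p → qInt p ⟨q^ n ÷ p ⟩) ps)
qInt∣∏qInt⟨q^⟩ [] {n} sf _ primes with n | squareFree⇒nonZero sf
... | suc zero    | _ = ε∣ʳ _
... | suc (suc k) | _ with ∃prime∣ (suc (suc k)) (s≤s (s≤s z≤n))
...   | p , p-prime , p∣n with () ← Equivalence.from primes (p-prime , p∣n)
qInt∣∏qInt⟨q^⟩ (p ∷ ps) {n} sf (p∉ps ∷ ps!) primes =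
  ∣ʳ-respˡ-≈ (≋-sym [n]≋[p][m]⟨q^p⟩) (∙-cong-∣ [p]∣[p]⟨q^m⟩ (∣ʳ-respʳ-≈ ∏≋∏ (⟨q^⟩-∣ p [m]∣∏)))
  where
  p-prime : Prime p
  p-prime = proj₁ (Equivalence.to primes (here refl))
  p∣n : p ∣ n
  p∣n = proj₂ (Equivalence.to primes (here refl))
  m : ℕ
  m = n ÷ p
  instance
    n≢0 : NonZero n
    n≢0 = squareFree⇒nonZero sf
    p≢0 : NonZero p
    p≢0 = prime⇒nonZero p-prime
    m≢0 : NonZero m
    m≢0 = ÷-nonZero p∣n
  n≡pm : n ≡ p * m
  n≡pm = sym (*-÷-cancel p∣n)
  primesₘ : ∀ {q} → q ∈ ps ⇔ (Prime q × q ∣ m)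
  primesₘ = primes-÷ sf p∉ps primes
  [m]∣∏ : qInt m ∣P productP (map (λ q → qInt q ⟨q^ m ÷ q ⟩) ps)
  [m]∣∏ = qInt∣∏qInt⟨q^⟩ ps (squareFree-∣ sf (÷-∣ p∣n)) ps! primesₘ
  ∏≋∏ : productP (map (λ q → qInt q ⟨q^ m ÷ q ⟩) ps) ⟨q^ p ⟩ ≋ productP (map (λ q → qInt q ⟨q^ n ÷ q ⟩) ps)
  ∏≋∏ = begin
    productP (map (λ q → qInt q ⟨q^ m ÷ q ⟩) ps) ⟨q^ p ⟩               ≈⟨ productP-⟨q^⟩ p (map (λ q → qInt q ⟨q^ m ÷ q ⟩) ps) ⟩
    productP (map (_⟨q^ p ⟩) (map (λ q → qInt q ⟨q^ m ÷ q ⟩) ps))      ≡⟨ cong productP (map-∘ ps) ⟨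
    productP (map (λ q → qInt q ⟨q^ m ÷ q ⟩ ⟨q^ p ⟩) ps)               ≈⟨ productP-cong ps termwise ⟩
    productP (map (λ q → qInt q ⟨q^ n ÷ q ⟩) ps)                       ∎
    where
    open ≋-Reasoning
    termwise : ∀ {q} → q ∈ ps → qInt q ⟨q^ m ÷ q ⟩ ⟨q^ p ⟩ ≋ qInt q ⟨q^ n ÷ q ⟩
    termwise {q} q∈ with Equivalence.to primesₘ q∈
    ... | q-prime , q∣m = ≋-trans (qInt⟨q^÷⟩⟨q^⟩ p q∣m) (≋-reflexive (cong (λ k → qInt q ⟨q^ k ÷ q ⟩) (sym n≡pm)))
      where
      instance
        q≢0 : NonZero q
        q≢0 = prime⇒nonZero q-prime
        m÷q≢0 : NonZero (m ÷ q)
        m÷q≢0 = ÷-nonZero q∣m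
  [n]≋[p][m]⟨q^p⟩ : qInt n ≋ qInt p *P qInt m ⟨q^ p ⟩
  [n]≋[p][m]⟨q^p⟩ = ≋-trans (≋-reflexive (cong qInt n≡pm)) (qInt-* p m)
  [p]∣[p]⟨q^m⟩ : qInt p ∣P qInt p ⟨q^ n ÷ p ⟩
  [p]∣[p]⟨q^m⟩ = qInt∣qInt⟨q^⟩ p m (prime∤⇒coprime p-prime (squareFree⇒∤÷ sf p-prime p∣n))

-- Evaluation at q = 1

evalAt1 : Poly → ℤ
evalAt1 []      = + 0
evalAt1 (c ∷ a) = c ℤ.+ evalAt1 a

evalAt1-+P : ∀ a b → evalAt1 (a +P b) ≡ evalAt1 a ℤ.+ evalAt1 b
evalAt1-+P []      b       = sym (ℤ.+-identityˡ _)
evalAt1-+P (x ∷ a) []      = sym (ℤ.+-identityʳ _)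
evalAt1-+P (x ∷ a) (y ∷ b) = trans (cong (λ s → x ℤ.+ y ℤ.+ s) (evalAt1-+P a b)) (regroup x y (evalAt1 a) (evalAt1 b))
  where
  regroup : ∀ x y u v → x ℤ.+ y ℤ.+ (u ℤ.+ v) ≡ x ℤ.+ u ℤ.+ (y ℤ.+ v)
  regroup = ℤ-Solver.solve-∀

evalAt1-scaleP : ∀ c a → evalAt1 (scaleP c a) ≡ c ℤ.* evalAt1 a
evalAt1-scaleP c []      = sym (ℤ.*-zeroʳ c)
evalAt1-scaleP c (x ∷ a) = trans (cong (λ s → c ℤ.* x ℤ.+ s) (evalAt1-scaleP c a)) (sym (ℤ.*-distribˡ-+ c x (evalAt1 a)))

evalAt1-*P : ∀ a b → evalAt1 (a *P b) ≡ evalAt1 a ℤ.* evalAt1 b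
evalAt1-*P []      b = refl
evalAt1-*P (x ∷ a) b = begin
  evalAt1 (scaleP x b +P (+ 0 ∷ a *P b))                ≡⟨ evalAt1-+P (scaleP x b) _ ⟩
  evalAt1 (scaleP x b) ℤ.+ (+ 0 ℤ.+ evalAt1 (a *P b))    ≡⟨ cong₂ (λ u v → u ℤ.+ (+ 0 ℤ.+ v)) (evalAt1-scaleP x b) (evalAt1-*P a b) ⟩
  x ℤ.* evalAt1 b ℤ.+ (+ 0 ℤ.+ evalAt1 a ℤ.* evalAt1 b)  ≡⟨ collect x (evalAt1 a) (evalAt1 b) ⟩
  (x ℤ.+ evalAt1 a) ℤ.* evalAt1 b                       ∎
  where
  open ≡-Reasoning
  collect : ∀ x u v → x ℤ.* v ℤ.+ (+ 0 ℤ.+ u ℤ.* v) ≡ (x ℤ.+ u) ℤ.* v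
  collect = ℤ-Solver.solve-∀

evalAt1-≋0 : ∀ {a} → a ≋ [] → evalAt1 a ≡ + 0
evalAt1-≋0 {[]}    _   = refl
evalAt1-≋0 {x ∷ a} a≋0 = cong₂ ℤ._+_ (∷≋0⇒head≡0 a≋0) (evalAt1-≋0 (∷≋0⇒tail≋0 a≋0))

evalAt1-cong : ∀ {a b} → a ≋ b → evalAt1 a ≡ evalAt1 b
evalAt1-cong {[]}    {b}     e = sym (evalAt1-≋0 (≋-sym e))
evalAt1-cong {x ∷ a} {[]}    e = evalAt1-≋0 e
evalAt1-cong {x ∷ a} {y ∷ b} e = cong₂ ℤ._+_ (∷-injectiveˡ e) (evalAt1-cong (∷-injectiveʳ e))

evalAt1-shift : ∀ k a → evalAt1 (shift k a) ≡ evalAt1 a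
evalAt1-shift zero    a = refl
evalAt1-shift (suc k) a = trans (ℤ.+-identityˡ _) (evalAt1-shift k a)

evalAt1-⟨q^⟩ : ∀ d a → evalAt1 (a ⟨q^ d ⟩) ≡ evalAt1 a
evalAt1-⟨q^⟩ d []      = refl
evalAt1-⟨q^⟩ d (x ∷ a) = cong (λ s → x ℤ.+ s) (trans (evalAt1-shift (d ℕ.∸ 1) _) (evalAt1-⟨q^⟩ d a))

evalAt1-qInt : ∀ n → evalAt1 (qInt n) ≡ + n
evalAt1-qInt zero    = refl
evalAt1-qInt (suc n) = cong (λ s → + 1 ℤ.+ s) (evalAt1-qInt n)

evalAt1-qPowMinus1 : ∀ n → evalAt1 (qPowMinus1 n) ≡ + 0
evalAt1-qPowMinus1 zero    = refl
evalAt1-qPowMinus1 (suc k) = trans (evalAt1-cong (qPowMinus1≋qMinus1⟨q^⟩ k)) (evalAt1-⟨q^⟩ (suc k) qMinus1)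

-- Cyclotomic polynomials at primes

cycloTable-keys≤ : ∀ k → All (λ e → proj₁ e ≤ k) (cycloTable k)
cycloTable-keys≤ zero = []
cycloTable-keys≤ (suc k) = All.++⁺ (All.map ℕ.m≤n⇒m≤1+n (cycloTable-keys≤ k)) (ℕ.≤-refl ∷ [])

cycloEntry : ℕ → List (ℕ × Poly) → Poly
cycloEntry k xs = divMonic (qPowMinus1 (suc k)) (productP (map proj₂ (filter (λ dp → proj₁ dp ∣? suc k) xs)))

-- Φ k looks k up in cycloTable k through a function private to Defs. The lemmas below hold for any
-- `look` with the same defining equations (`look-∷` standing for its with-clause); at the use site
-- both functions are found by unification once the table and the decision are abstracted.
module _ {K : ℕ} {X : Poly} (look : List (ℕ × Poly) → Poly)
         (look-∷ : (d : ℕ) → Poly → List (ℕ × Poly) → Dec (d ≡ K) → Poly)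
         (unfold : ∀ d p ps → look ((d , p) ∷ ps) ≡ look-∷ d p ps (d ℕ.≟ K))
         (miss : ∀ d p ps ne → look-∷ d p ps (no ne) ≡ look ps)
         (hit : ∀ d p ps e → look-∷ d p ps (yes e) ≡ p) where

  lookup-last : ∀ xs → All (λ e → proj₁ e ≢ K) xs → look (xs ++ [ (K , X) ]) ≡ X
  lookup-last [] [] with K ℕ.≟ K | unfold K X []
  ... | yes e | eq = trans eq (hit K X [] e)
  ... | no ne | _ = ⊥-elim (ne refl)
  lookup-last ((d , p) ∷ xs) (d≢K ∷ below) with d ℕ.≟ K | unfold d p (xs ++ [ (K , X) ])
  ... | yes d≡K | _ = ⊥-elim (d≢K d≡K)
  ... | no ne | eq = trans eq (trans (miss d p _ ne) (lookup-last xs below))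

  lookup-last-∷ : ∀ d p ps → d ≢ K → All (λ e → proj₁ e ≢ K) ps →
                  ∀ T z → ps ++ [ (K , X) ] ≡ T → (d ℕ.≟ K) ≡ z → look-∷ d p T z ≡ X
  lookup-last-∷ d p ps d≢K below _ _ refl refl = trans (sym (unfold d p _)) (lookup-last ((d , p) ∷ ps) (d≢K ∷ below))

Φ-last : ∀ k → Φ (suc k) ≡ cycloEntry k (cycloTable k)
Φ-last k with cycloTable k | All.map (λ le eq → ℕ.<-irrefl eq (s≤s le)) (cycloTable-keys≤ k)
               | lookup-last-∷ {suc k} {cycloEntry k (cycloTable k)} _ _ (λ _ _ _ → refl) (λ _ _ _ _ → refl) (λ _ _ _ _ → refl)
... | [] | [] | _ with suc k ℕ.≟ suc k
... | yes _ = refl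
... | no ne = ⊥-elim (ne refl)
Φ-last k | (d , p) ∷ ps | d≢k+1 ∷ below | last with ps ++ [ (suc k , cycloEntry k ((d , p) ∷ ps)) ] in eqT | d ℕ.≟ suc k in eq
... | T | z = last d p ps d≢k+1 below T z eqT eq

replicate-∷ʳ : ∀ {A : Set} n (x : A) → replicate n x ∷ʳ x ≡ x ∷ replicate n x
replicate-∷ʳ zero    x = refl
replicate-∷ʳ (suc n) x = cong (x ∷_) (replicate-∷ʳ n x)

reverse-replicate : ∀ {A : Set} n (x : A) → reverse (replicate n x) ≡ replicate n x
reverse-replicate zero    x = refl
reverse-replicate (suc n) x = trans (unfold-reverse x (replicate n x)) (trans (cong (_∷ʳ x) (reverse-replicate n x)) (replicate-∷ʳ n x))

reverse-qPowMinus1 : ∀ k → reverse (qPowMinus1 (suc k)) ≡ + 1 ∷ replicate k (+ 0) ++ [ -[1+ 0 ] ]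
reverse-qPowMinus1 k = begin
  reverse (-[1+ 0 ] ∷ replicate k (+ 0) ++ [ + 1 ])   ≡⟨ unfold-reverse -[1+ 0 ] (replicate k (+ 0) ++ [ + 1 ]) ⟩
  reverse (replicate k (+ 0) ++ [ + 1 ]) ∷ʳ -[1+ 0 ]   ≡⟨ cong (_∷ʳ -[1+ 0 ]) (reverse-++ (replicate k (+ 0)) [ + 1 ]) ⟩
  (+ 1 ∷ reverse (replicate k (+ 0))) ∷ʳ -[1+ 0 ]      ≡⟨ cong (λ zs → (+ 1 ∷ zs) ∷ʳ -[1+ 0 ]) (reverse-replicate k (+ 0)) ⟩
  + 1 ∷ replicate k (+ 0) ++ [ -[1+ 0 ] ]              ∎
  where open ≡-Reasoning

-- divMonic divides reversed coefficient lists by a helper private to Defs. Once the reversed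
-- dividends are rewritten, one division step computes; abstracting the two folds implementing
-- reverse lets unification recover the quotient of the smaller division, which cannot be named.
divMonic-step : ∀ k → divMonic (qPowMinus1 (suc (suc k))) qMinus1 ≡ divMonic (qPowMinus1 (suc k)) qMinus1 ∷ʳ + 1
divMonic-step k
  with reverse (qPowMinus1 (suc (suc k))) | reverse-qPowMinus1 (suc k)
     | reverse (qPowMinus1 (suc k)) | reverse-qPowMinus1 k
... | _ | refl | _ | refl
  with reverse (reverse (+ 1 ∷ replicate (suc k) (+ 0) ++ [ -[1+ 0 ] ])) | reverse-involutive (+ 1 ∷ replicate (suc k) (+ 0) ++ [ -[1+ 0 ] ])
     | reverse (reverse (+ 1 ∷ replicate k (+ 0) ++ [ -[1+ 0 ] ])) | reverse-involutive (+ 1 ∷ replicate k (+ 0) ++ [ -[1+ 0 ] ])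
... | _ | refl | _ | refl
  with foldl {A = List ℤ} (flip _∷_) [ + 1 ] | foldl {A = List ℤ} (flip _∷_) [] | unfold-reverse {A = ℤ} (+ 1)
... | rev₁ | rev | rev₁≡rev∷ʳ = rev₁≡rev∷ʳ _

divMonic-qPowMinus1 : ∀ k → divMonic (qPowMinus1 (suc k)) qMinus1 ≡ qInt (suc k)
divMonic-qPowMinus1 zero = refl
divMonic-qPowMinus1 (suc k) = trans (divMonic-step k) (trans (cong (_∷ʳ + 1) (divMonic-qPowMinus1 k)) (replicate-∷ʳ (suc k) (+ 1)))

cycloTable-shape : ∀ j → ∃ λ R → cycloTable (suc j) ≡ (1 , qMinus1) ∷ R × All (λ e → 2 ≤ proj₁ e × proj₁ e ≤ suc j) R
cycloTable-shape zero    = [] , refl , []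
cycloTable-shape (suc j) with cycloTable-shape j
... | R , eq , bounds = R ++ [ new ] , cong (_++ [ new ]) eq ,
      All.++⁺ (All.map (λ (2≤ , ≤j) → 2≤ , ℕ.m≤n⇒m≤1+n ≤j) bounds) ((s≤s (s≤s z≤n) , ℕ.≤-refl) ∷ [])
  where
  new : ℕ × Poly
  new = suc (suc j) , cycloEntry (suc j) (cycloTable (suc j))

Φ-prime : ∀ {p} → Prime p → Φ p ≡ qInt p
Φ-prime {suc (suc j)} p-prime with cycloTable-shape j
... | R , eq , bounds = begin
  Φ (suc (suc j))                                  ≡⟨ Φ-last (suc j) ⟩
  cycloEntry (suc j) (cycloTable (suc j))          ≡⟨ cong (cycloEntry (suc j)) eq ⟩
  cycloEntry (suc j) ((1 , qMinus1) ∷ R)           ≡⟨ cong (λ xs → divMonic (qPowMinus1 (suc (suc j))) (productP (map proj₂ xs))) only-1 ⟩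
  divMonic (qPowMinus1 (suc (suc j))) qMinus1      ≡⟨ divMonic-qPowMinus1 (suc j) ⟩
  qInt (suc (suc j))                               ∎
  where
  open ≡-Reasoning
  ∤p : ∀ {d} → 2 ≤ d × d ≤ suc j → ¬ d ∣ suc (suc j)
  ∤p (2≤d , d≤j) d∣p with prime⇒irreducible p-prime d∣p
  ... | inj₁ refl = ℕ.<-irrefl refl 2≤d
  ... | inj₂ refl = ℕ.<-irrefl refl d≤j
  divides? : Decidable (λ (dp : ℕ × Poly) → proj₁ dp ∣ suc (suc j))
  divides? dp = proj₁ dp ∣? suc (suc j)
  only-1 : filter divides? ((1 , qMinus1) ∷ R) ≡ [ (1 , qMinus1) ]
  only-1 = trans (filter-accept divides? {xs = R} (1∣ _)) (cong (_ ∷_) (filter-none divides? (All.map ∤p bounds)))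

substPow-Φ : ∀ d {p} → Prime p → substPow d (Φ p) ≋ qInt p ⟨q^ d ⟩
substPow-Φ d {p} p-prime = ≋-trans (substPow≋⟨q^⟩ d (Φ p)) (≋-reflexive (cong (_⟨q^ d ⟩) (Φ-prime p-prime)))

-- S m and G m unfold, through a helper private to Defs, only once the selected prime factor is
-- exposed as a successor.
S≋qInt⟨q^⟩ : ∀ m → 1 < m → S m ≋ qInt (spf m) ⟨q^ m ÷ spf m ⟩
S≋qInt⟨q^⟩ 1 (s≤s ())
S≋qInt⟨q^⟩ m@(suc (suc _)) 1<m with spf m | Extremal.isPrime (spf-extremal m 1<m)
... | zero  | p-prime = contradiction p-prime ¬prime[0]
... | suc _ | p-prime = substPow-Φ _ p-prime

G≋qInt⟨q^⟩ : ∀ m → 1 < m → G m ≋ qInt (gpf m) ⟨q^ m ÷ gpf m ⟩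
G≋qInt⟨q^⟩ 1 (s≤s ())
G≋qInt⟨q^⟩ m@(suc (suc _)) 1<m with gpf m | Extremal.isPrime (gpf-extremal m 1<m)
... | zero  | p-prime = contradiction p-prime ¬prime[0]
... | suc _ | p-prime = substPow-Φ _ p-prime

-- Sequences built from an extreme prime factor

module ExtremePrimeFactorSequence
  (a : ℕ → Poly) (E E′ : ℕ → ℕ) (_≼_ : ℕ → ℕ → Set)
  (≼-antisym : ∀ {x y} → x ≼ y → y ≼ x → x ≡ y)
  (E-extremal : ∀ m → 1 < m → Extremal _≼_ m (E m))
  (E′-extremal : ∀ m → 1 < m → Extremal (flip _≼_) m (E′ m))
  (a-1 : a 1 ≡ qMinus1)
  (a-E : ∀ m → 1 < m → a m ≋ qInt (E m) ⟨q^ m ÷ E m ⟩)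
  where

  open Extremal

  term : ℕ → ℕ → Poly
  term n d = substPow d (a (n ÷ d))

  E-prime : ∀ {p} → Prime p → E p ≡ p
  E-prime p-prime = prime≡ (isPrime Eₚ) p-prime (∣m Eₚ)
    where
    Eₚ : Extremal _≼_ _ (E _)
    Eₚ = E-extremal _ (prime⇒1< p-prime)

  E-* : ∀ {r m} → Prime r → 1 < m → E m ≼ r → E (r * m) ≡ E m
  E-* {r} {m} r-prime 1<m Eₘ≼r = ≼-antisym (extremal Eᵣₘ (isPrime Eₘ) (∣-trans (∣m Eₘ) (ℕ∣.n∣m*n r))) Eₘ≼Eᵣₘ
    where
    Eₘ : Extremal _≼_ m (E m)
    Eₘ = E-extremal m 1<m
    Eᵣₘ : Extremal _≼_ (r * m) (E (r * m))
    Eᵣₘ = E-extremal (r * m) (ℕ.<-≤-trans 1<m (ℕ.m≤n*m m r {{prime⇒nonZero r-prime}}))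
    Eₘ≼Eᵣₘ : E m ≼ E (r * m)
    Eₘ≼Eᵣₘ with euclidsLemma r m (isPrime Eᵣₘ) (∣m Eᵣₘ)
    ... | inj₁ Eᵣₘ∣r = subst (E m ≼_) (sym (prime≡ (isPrime Eᵣₘ) r-prime Eᵣₘ∣r)) Eₘ≼r
    ... | inj₂ Eᵣₘ∣m = extremal Eₘ (isPrime Eᵣₘ) Eᵣₘ∣m

  term-self : ∀ n .{{_ : NonZero n}} → term n n ≋ qPowMinus1 n
  term-self n@(suc k) = begin
    substPow n (a (n ÷ n))   ≡⟨ cong (substPow n ∘ a) (n÷n≡1 n) ⟩
    substPow n (a 1)         ≡⟨ cong (substPow n) a-1 ⟩
    substPow n qMinus1       ≈⟨ substPow≋⟨q^⟩ n qMinus1 ⟩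
    qMinus1 ⟨q^ n ⟩          ≈⟨ qPowMinus1≋qMinus1⟨q^⟩ k ⟨
    qPowMinus1 n             ∎
    where open ≋-Reasoning

  term-proper : ∀ {n d} .{{_ : NonZero n}} → d ∣ n → d ≢ n → term n d ≋ qInt (E (n ÷ d)) ⟨q^ n ÷ E (n ÷ d) ⟩
  term-proper {n} {d} d∣n d≢n = begin
    substPow d (a m)                        ≈⟨ substPow≋⟨q^⟩ d (a m) ⟩
    a m ⟨q^ d ⟩                             ≈⟨ ⟨q^⟩-cong d (a-E m 1<m) ⟩
    qInt p ⟨q^ m ÷ p ⟩ ⟨q^ d ⟩              ≈⟨ ⟨q^⟩-⟨q^⟩ d (m ÷ p) {{d≢0}} {{÷-nonZero (∣m Eₘ)}} (qInt p) ⟩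
    qInt p ⟨q^ d * (m ÷ p) ⟩                ≡⟨ cong (qInt p ⟨q^_⟩) n÷p≡d*[m÷p] ⟨
    qInt p ⟨q^ n ÷ p ⟩                      ∎
    where
    open ≋-Reasoning
    m p : ℕ
    m = n ÷ d
    p = E m
    instance
      d≢0 : NonZero d
      d≢0 = ∣⇒nonZero d∣n
      m≢0 : NonZero m
      m≢0 = ÷-nonZero d∣n
    1<m : 1 < m
    1<m = 1<÷ d∣n d≢n
    Eₘ : Extremal _≼_ m p
    Eₘ = E-extremal m 1<m
    instance
      p≢0 : NonZero p
      p≢0 = prime⇒nonZero (isPrime Eₘ)
    n÷p≡d*[m÷p] : n ÷ p ≡ d * (m ÷ p)
    n÷p≡d*[m÷p] = trans (cong (_÷ p) (sym (*-÷-cancel d∣n))) (*-÷-assoc d (∣m Eₘ))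

  term-cofactor : ∀ {n p} .{{_ : NonZero n}} → Prime p → p ∣ n → term n (n ÷ p) ≋ qInt p ⟨q^ n ÷ p ⟩
  term-cofactor {n} {p} p-prime p∣n = ≋-trans (term-proper (÷-∣ p∣n) (÷-≢ (prime⇒1< p-prime) p∣n))
    (≋-reflexive (cong (λ q → qInt q ⟨q^ n ÷ q ⟩) (trans (cong E (÷-÷ p∣n)) (E-prime p-prime))))
    where
    instance
      p≢0 : NonZero p
      p≢0 = prime⇒nonZero p-prime

  module _ {n : ℕ} (1<n : 1 < n) where
    private
      E′ₙ : Extremal (flip _≼_) n (E′ n)
      E′ₙ = E′-extremal n 1<n
      r : ℕ
      r = E′ n
      r-prime : Prime r
      r-prime = isPrime E′ₙ
      r∣n : r ∣ n
      r∣n = ∣m E′ₙ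
      instance
        n≢0 : NonZero n
        n≢0 = ℕ.>-nonZero (ℕ.<-trans ℕ.z<s 1<n)
        r≢0 : NonZero r
        r≢0 = prime⇒nonZero r-prime

    -- n / e = r (n / e r), and E′ n = r lies on the far side of every prime factor of n / e r.
    E-cofactor-invariant : ∀ {e} → ¬ r ∣ e → e * r ∣ n → e * r ≢ n → E (n ÷ e) ≡ E (n ÷ (e * r))
    E-cofactor-invariant {e} r∤e er∣n er≢n = trans (cong E n÷e≡r*m) (E-* r-prime 1<m Eₘ≼r)
      where
      instance
        er≢0 : NonZero (e * r)
        er≢0 = ∣⇒nonZero er∣n
        e≢0 : NonZero e
        e≢0 = ℕ.m*n≢0⇒m≢0 e
      m : ℕ
      m = n ÷ (e * r)
      1<m : 1 < m
      1<m = 1<÷ er∣n er≢n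
      Eₘ≼r : E m ≼ r
      Eₘ≼r = extremal E′ₙ (isPrime (E-extremal m 1<m)) (∣-trans (∣m (E-extremal m 1<m)) (÷-∣ er∣n))
      n÷e≡r*m : n ÷ e ≡ r * m
      n÷e≡r*m = begin
        n ÷ e                  ≡⟨ cong (_÷ e) (*-÷-cancel er∣n) ⟨
        (e * r * m) ÷ e        ≡⟨ cong (_÷ e) (ℕ.*-assoc e r m) ⟩
        (e * (r * m)) ÷ e      ≡⟨ *-÷-cancelˡ (r * m) e ⟩
        r * m                  ∎
        where open ≡-Reasoning

    term-toggle : ∀ {d} → d ∣ n → SquareFree d → d ≢ n → toggle r d ≢ n → term n (toggle r d) ≋ term n d
    term-toggle {d} d∣n sf d≢n t≢n = begin
      term n (toggle r d)                                       ≈⟨ term-proper t∣n t≢n ⟩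
      qInt (E (n ÷ toggle r d)) ⟨q^ n ÷ E (n ÷ toggle r d) ⟩    ≡⟨ cong (λ p → qInt p ⟨q^ n ÷ p ⟩) E[n÷t]≡E[n÷d] ⟩
      qInt (E (n ÷ d)) ⟨q^ n ÷ E (n ÷ d) ⟩                      ≈⟨ term-proper d∣n d≢n ⟨
      term n d                                                  ∎
      where
      open ≋-Reasoning
      t∣n : toggle r d ∣ n
      t∣n = toggle-∣ r-prime sf r∣n d∣n
      E[n÷t]≡E[n÷d] : E (n ÷ toggle r d) ≡ E (n ÷ d)
      E[n÷t]≡E[n÷d] with togglePair r-prime sf
      ... | record { r∤base = r∤e ; cases = inj₁ (refl , t≡er) } = trans (cong (λ t → E (n ÷ t)) t≡er)
            (sym (E-cofactor-invariant r∤e (subst (_∣ n) t≡er t∣n) (subst (_≢ n) t≡er t≢n)))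
      ... | record { r∤base = r∤e ; cases = inj₂ (refl , t≡e) } = trans (cong (λ t → E (n ÷ t)) t≡e)
            (E-cofactor-invariant r∤e d∣n d≢n)

    toggle-pairs-signs : ∀ ε → ε ≢ + 0 → PairedBy (toggle r) (divisorsWithμ ε n) (divisorsWithμ (ℤ.- ε) n)
    toggle-pairs-signs ε ε≢0 = record
      { ι-∈ʳ = toggle-∈ ε≢0
      ; ι-∈ˡ = subst (λ ε′ → _ ∈ divisorsWithμ ε′ n) (ℤ.neg-involutive ε) ∘ toggle-∈ (ε≢0 ∘ ℤ.neg-injective)
      ; ιι≡idˡ = λ d∈ → toggle-involutive r-prime (∈-divisorsWithμ⇒squareFree {n = n} ε≢0 d∈)
      ; ιι≡idʳ = λ d∈ → toggle-involutive r-prime (∈-divisorsWithμ⇒squareFree {n = n} (ε≢0 ∘ ℤ.neg-injective) d∈) }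
      where
      toggle-∈ : ∀ {ε d} → ε ≢ + 0 → d ∈ divisorsWithμ ε n → toggle r d ∈ divisorsWithμ (ℤ.- ε) n
      toggle-∈ ε≢0 d∈ with ∈-divisorsWithμ⁻ {n = n} d∈
      ... | d∣n , μd≡ε = ∈-divisorsWithμ⁺ (toggle-∣ r-prime sf r∣n d∣n) (trans (μ-toggle r-prime sf) (cong ℤ.-_ μd≡ε))
        where
        sf : SquareFree _
        sf = ∈-divisorsWithμ⇒squareFree {n = n} ε≢0 d∈

    -- Toggling r matches the divisors with μ = 1 with those with μ = -1; as n is not squarefree,
    -- neither d nor its toggle is n, so the matched factors agree.
    divProd-nonSquareFree : ¬ SquareFree n → divProd a (+ 1) n ≋ divProd a -[1+ 0 ] n
    divProd-nonSquareFree ¬sf = productP-pairedBy (divisorsWithμ-unique _ n) (divisorsWithμ-unique _ n)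
      (toggle-pairs-signs (+ 1) (λ ())) (term n) term-toggle-∈
      where
      term-toggle-∈ : ∀ {d} → d ∈ divisorsWithμ (+ 1) n → term n (toggle r d) ≋ term n d
      term-toggle-∈ d∈ = term-toggle (proj₁ (∈-divisorsWithμ⁻ {n = n} d∈)) sf
        (λ d≡n → ¬sf (subst SquareFree d≡n sf)) (λ t≡n → ¬sf (subst SquareFree t≡n (toggle-squareFree r-prime sf)))
        where
        sf : SquareFree _
        sf = ∈-divisorsWithμ⇒squareFree {n = n} (λ ()) d∈

    module _ (sf : SquareFree n) where
      private
        m′ : ℕ
        m′ = n ÷ r
        n≡m′*r : n ≡ m′ * r
        n≡m′*r = trans (sym (*-÷-cancel r∣n)) (ℕ.*-comm r m′)
        m′≢n : m′ ≢ n
        m′≢n = ÷-≢ (prime⇒1< r-prime) r∣n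
        toggle-n : toggle r n ≡ m′
        toggle-n = trans (cong (toggle r) n≡m′*r) toggle-*
        toggle-m′ : toggle r m′ ≡ n
        toggle-m′ = trans (toggle-∤ (squareFree⇒∤÷ sf r-prime r∣n)) (sym n≡m′*r)
        other? : Decidable (λ d → d ≢ n × d ≢ m′)
        other? d = ¬? (d ℕ.≟ n) ×-dec ¬? (d ℕ.≟ m′)
        others : List ℕ
        others = filter other? (divisors n)
        others-unique : Unique others
        others-unique = Unique.filter⁺ other? (divisors-unique n)
        ∈-others⁻ : ∀ {d} → d ∈ others → d ∣ n × d ≢ n × d ≢ m′
        ∈-others⁻ d∈ with ∈-filter⁻ other? {xs = divisors n} d∈
        ... | d∈divisors , d≢n , d≢m′ = ∈-divisors⁻ n d∈divisors , d≢n , d≢m′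
        divisors↭ : divisors n ↭ n ∷ m′ ∷ others
        divisors↭ = ↭-fromMembership (divisors-unique n)
          ((m′≢n ∘ sym ∷ All.tabulate (λ d∈ n≡d → proj₁ (proj₂ (∈-others⁻ d∈)) (sym n≡d)))
            ∷ All.tabulate (λ d∈ m′≡d → proj₂ (proj₂ (∈-others⁻ d∈)) (sym m′≡d)) ∷ others-unique)
          (mk⇔ to from)
          where
          to : ∀ {d} → d ∈ divisors n → d ∈ n ∷ m′ ∷ others
          to {d} d∈ with d ℕ.≟ n | d ℕ.≟ m′
          ... | yes refl | _        = here refl
          ... | no _     | yes refl = there (here refl)
          ... | no d≢n   | no d≢m′  = there (there (∈-filter⁺ other? d∈ (d≢n , d≢m′)))
          from : ∀ {d} → d ∈ n ∷ m′ ∷ others → d ∈ divisors n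
          from (here refl)         = ∈-divisors⁺ (ℕ∣.∣-refl {n})
          from (there (here refl)) = ∈-divisors⁺ (÷-∣ r∣n)
          from (there (there d∈))  = proj₁ (∈-filter⁻ other? {xs = divisors n} d∈)
        toggle-pairs-others : PairedBy (toggle r) others others
        toggle-pairs-others = record { ι-∈ʳ = toggle-∈ ; ι-∈ˡ = toggle-∈ ; ιι≡idˡ = involutive ; ιι≡idʳ = involutive }
          where
          involutive : ∀ {d} → d ∈ others → toggle r (toggle r d) ≡ d
          involutive d∈ = toggle-involutive r-prime (squareFree-∣ sf (proj₁ (∈-others⁻ d∈)))
          toggle-∈ : ∀ {d} → d ∈ others → toggle r d ∈ others
          toggle-∈ {d} d∈ with ∈-others⁻ d∈
          ... | d∣n , d≢n , d≢m′ = ∈-filter⁺ other? (∈-divisors⁺ (toggle-∣ r-prime (squareFree-∣ sf d∣n) r∣n d∣n))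
                (  (λ t≡n → d≢m′ (trans (sym (involutive d∈)) (trans (cong (toggle r) t≡n) toggle-n)))
                 , (λ t≡m′ → d≢n (trans (sym (involutive d∈)) (trans (cong (toggle r) t≡m′) toggle-m′))))
        summand : ℕ → Poly
        summand d = scaleP (μ d) (term n d)
        summand-toggle : ∀ {d} → d ∈ others → summand (toggle r d) ≋ -P summand d
        summand-toggle {d} d∈ with ∈-others⁻ d∈ | ∈-others⁻ (PairedBy.ι-∈ʳ toggle-pairs-others d∈)
        ... | d∣n , d≢n , _ | _ , t≢n , _ = begin
          scaleP (μ (toggle r d)) (term n (toggle r d))   ≡⟨ cong (λ c → scaleP c (term n (toggle r d))) (μ-toggle r-prime sf-d) ⟩
          scaleP (ℤ.- μ d) (term n (toggle r d))          ≈⟨ scaleP-cong (ℤ.- μ d) (term-toggle d∣n sf-d d≢n t≢n) ⟩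
          scaleP (ℤ.- μ d) (term n d)                     ≈⟨ scaleP-neg (μ d) (term n d) ⟩
          -P summand d                                    ∎
          where
          open ≋-Reasoning
          sf-d : SquareFree d
          sf-d = squareFree-∣ sf d∣n

      -- Toggling r pairs off the divisors other than n and n / r with opposite signs.
      mobiusSum-squareFree : mobiusSum a n ≋ scaleP (μ n) (qPowMinus1 n) +P scaleP (μ (n ÷ E′ n)) (qInt (E′ n) ⟨q^ n ÷ E′ n ⟩)
      mobiusSum-squareFree = begin
        sumP (map summand (divisors n))                           ≈⟨ sumP-↭ summand divisors↭ ⟩
        summand n +P (summand m′ +P sumP (map summand others))    ≈⟨ +P-cong summand-n (+P-cong summand-m′ others-cancel) ⟩
        W₁ +P (W₂ +P [])                                          ≈⟨ +P-cong ≋-refl (+P-identityʳ W₂) ⟩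
        W₁ +P W₂                                                  ∎
        where
        open ≋-Reasoning
        W₁ W₂ : Poly
        W₁ = scaleP (μ n) (qPowMinus1 n)
        W₂ = scaleP (μ m′) (qInt r ⟨q^ n ÷ r ⟩)
        summand-n : summand n ≋ W₁
        summand-n = scaleP-cong (μ n) (term-self n)
        summand-m′ : summand m′ ≋ W₂
        summand-m′ = scaleP-cong (μ m′) (term-cofactor r-prime r∣n)
        others-cancel : sumP (map summand others) ≋ []
        others-cancel = sumP-pairedBy-≋0 summand others-unique toggle-pairs-others summand-toggle

      evalAt1-mobiusSum : evalAt1 (mobiusSum a n) ≡ μ (n ÷ E′ n) ℤ.* + E′ n
      evalAt1-mobiusSum = begin
        evalAt1 (mobiusSum a n)                                                ≡⟨ evalAt1-cong mobiusSum-squareFree ⟩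
        evalAt1 (scaleP (μ n) (qPowMinus1 n) +P scaleP (μ m′) (qInt r ⟨q^ m′ ⟩)) ≡⟨ evalAt1-+P (scaleP (μ n) (qPowMinus1 n)) (scaleP (μ m′) (qInt r ⟨q^ m′ ⟩)) ⟩
        evalAt1 (scaleP (μ n) (qPowMinus1 n)) ℤ.+ evalAt1 (scaleP (μ m′) (qInt r ⟨q^ m′ ⟩))
                                                                               ≡⟨ cong₂ ℤ._+_ (evalAt1-scaleP (μ n) (qPowMinus1 n)) (evalAt1-scaleP (μ m′) (qInt r ⟨q^ m′ ⟩)) ⟩
        μ n ℤ.* evalAt1 (qPowMinus1 n) ℤ.+ μ m′ ℤ.* evalAt1 (qInt r ⟨q^ m′ ⟩)   ≡⟨ cong₂ (λ x y → μ n ℤ.* x ℤ.+ μ m′ ℤ.* y) (evalAt1-qPowMinus1 n)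
                                                                                    (trans (evalAt1-⟨q^⟩ m′ (qInt r)) (evalAt1-qInt r)) ⟩
        μ n ℤ.* + 0 ℤ.+ μ m′ ℤ.* + r                                           ≡⟨ cong (ℤ._+ μ m′ ℤ.* + r) (ℤ.*-zeroʳ (μ n)) ⟩
        + 0 ℤ.+ μ m′ ℤ.* + r                                                   ≡⟨ ℤ.+-identityˡ _ ⟩
        μ m′ ℤ.* + r                                                           ∎
        where open ≡-Reasoning

  qInt∣divProd-μ : ∀ n .{{_ : NonZero n}} → qInt n ∣P divProd a (μ n) n
  qInt∣divProd-μ n = ∣ʳ-trans [n]∣term (∈⇒∣productP (term n) (∈-divisorsWithμ⁺ (ℕ∣.∣-refl {n}) refl))
    where
    [n]∣term : qInt n ∣P term n n
    [n]∣term = qMinus1 , ≋-trans (qMinus1*qInt n) (≋-sym (term-self n))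

  -- The divisors n / p, for the prime factors p, have μ = -μ n and contribute ∏_p [p]_{q^{n/p}}.
  qInt∣divProd-−μ : ∀ {n} → SquareFree n → qInt n ∣P divProd a (ℤ.- μ n) n
  qInt∣divProd-−μ {n} sf = ∣ʳ-trans (qInt∣∏qInt⟨q^⟩ (primeDivisors n) sf (primeDivisors-unique n) ∈-primeDivisors⇔)
    (∣ʳ-respˡ-≈ ∏term≋∏qInt (productP-⊆-∣ (term n) cofactors-unique (divisorsWithμ-unique _ n) cofactors⊆))
    where
    instance
      n≢0 : NonZero n
      n≢0 = squareFree⇒nonZero sf
    cofactors : List ℕ
    cofactors = map (n ÷_) (primeDivisors n)
    n÷[n÷p]≡p : ∀ {p} → p ∈ primeDivisors n → n ÷ (n ÷ p) ≡ p
    n÷[n÷p]≡p p∈ with ∈-primeDivisors⁻ n p∈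
    ... | p-prime , p∣n = ÷-÷ {{n≢0}} {{prime⇒nonZero p-prime}} p∣n
    cofactors-unique : Unique cofactors
    cofactors-unique = unique-map {n ÷_} {n ÷_} n÷[n÷p]≡p (primeDivisors-unique n)
    cofactors⊆ : ∀ {d} → d ∈ cofactors → d ∈ divisorsWithμ (ℤ.- μ n) n
    cofactors⊆ d∈ with ∈-map⁻ (n ÷_) d∈
    ... | p , p∈ , refl with ∈-primeDivisors⁻ n p∈
    ...   | p-prime , p∣n = ∈-divisorsWithμ⁺ (÷-∣ {{prime⇒nonZero p-prime}} p∣n) (μ-÷ sf p-prime p∣n)
    ∏term≋∏qInt : productP (map (term n) cofactors) ≋ productP (map (λ p → qInt p ⟨q^ n ÷ p ⟩) (primeDivisors n))
    ∏term≋∏qInt = ≋-trans (≋-reflexive (cong productP (sym (map-∘ (primeDivisors n)))))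
      (productP-cong (primeDivisors n) λ p∈ → term-cofactor (proj₁ (∈-primeDivisors⁻ n p∈)) (proj₂ (∈-primeDivisors⁻ n p∈)))

  qInt∣divProd : ∀ {n} → SquareFree n → ∀ ε → μ n ≡ ε ⊎ μ n ≡ ℤ.- ε → qInt n ∣P divProd a ε n
  qInt∣divProd {n} sf ε (inj₁ refl)  = qInt∣divProd-μ n {{squareFree⇒nonZero sf}}
  qInt∣divProd {n} sf ε (inj₂ μ≡-ε) =
    subst (λ ε → qInt n ∣P divProd a ε n) (trans (cong ℤ.-_ μ≡-ε) (ℤ.neg-involutive ε)) (qInt∣divProd-−μ sf)

  isQEulerGauss : IsQEulerGauss a
  isQEulerGauss n 1≤n with squareFree? n {{ℕ.>-nonZero 1≤n}}
  ... | yes sf  = ∣⇒≡P[mod] (divProd a (+ 1) n) (divProd a -[1+ 0 ] n)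
                    (∣-minusP (qInt∣divProd sf (+ 1) (μ≡±1 sf)) (qInt∣divProd sf -[1+ 0 ] (swap (μ≡±1 sf))))
  ... | no  ¬sf = ∣⇒≡P[mod] (divProd a (+ 1) n) (divProd a -[1+ 0 ] n)
                    ([] , ≋-sym (≋-trans (+P-cong (divProd-nonSquareFree (¬squareFree⇒1< 1≤n ¬sf) ¬sf) ≋-refl) (-P-inverseʳ (divProd a -[1+ 0 ] n))))

  -- At q = 1 a multiple of [n]_q takes a value divisible by n, but the Möbius sum takes the value
  -- ±E′ n, a proper factor of n.
  mobiusSum-≢0 : ∀ n → Composite n → SquareFree n → ¬ (mobiusSum a n ≡P zeroP [mod qInt n ])
  mobiusSum-≢0 n composite sf (h , sum≈h[n]) = ≢-multiple r<n ℤ.∣ evalAt1 h ∣ (begin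
    r                              ≡⟨ trans (cong (ℕ._* r) (∣μ∣≡1 (squareFree-∣ sf (÷-∣ r∣n)))) (ℕ.*-identityˡ r) ⟨
    ℤ.∣ μ (n ÷ r) ∣ ℕ.* r          ≡⟨ ℤ.abs-* (μ (n ÷ r)) (+ r) ⟨
    ℤ.∣ μ (n ÷ r) ℤ.* + r ∣        ≡⟨ cong ℤ.∣_∣ (evalAt1-mobiusSum 1<n sf) ⟨
    ℤ.∣ evalAt1 (mobiusSum a n) ∣  ≡⟨ cong ℤ.∣_∣ (evalAt1-cong sum≋h[n]) ⟩
    ℤ.∣ evalAt1 (h *P qInt n) ∣    ≡⟨ cong ℤ.∣_∣ (trans (evalAt1-*P h (qInt n)) (cong (evalAt1 h ℤ.*_) (evalAt1-qInt n))) ⟩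
    ℤ.∣ evalAt1 h ℤ.* + n ∣        ≡⟨ ℤ.abs-* (evalAt1 h) (+ n) ⟩
    ℤ.∣ evalAt1 h ∣ ℕ.* n          ∎)
    where
    open ≡-Reasoning
    1<n : 1 < n
    1<n = nonTrivial⇒n>1 n {{composite⇒nonTrivial composite}}
    r : ℕ
    r = E′ n
    r-prime : Prime r
    r-prime = isPrime (E′-extremal n 1<n)
    instance
      r≢0 : NonZero r
      r≢0 = prime⇒nonZero r-prime
    r∣n : r ∣ n
    r∣n = ∣m (E′-extremal n 1<n)
    r<n : r < n
    r<n = prime∣composite⇒< composite r-prime r∣n
    sum≋h[n] : mobiusSum a n ≋ h *P qInt n
    sum≋h[n] = ≋-trans (≋-sym (+P-identityʳ (mobiusSum a n))) (coeffwise {mobiusSum a n -P zeroP} {h *P qInt n} sum≈h[n])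

module S-sequence = ExtremePrimeFactorSequence S spf gpf _≤_ ℕ.≤-antisym spf-extremal gpf-extremal refl S≋qInt⟨q^⟩
module G-sequence = ExtremePrimeFactorSequence G gpf spf _≥_ (flip ℕ.≤-antisym) gpf-extremal spf-extremal refl G≋qInt⟨q^⟩

theorem10 : IsQEulerGauss S × IsQEulerGauss G
            × (∀ (n : ℕ) → Composite n → SquareFree n →
                 ¬ (mobiusSum S n ≡P zeroP [mod qInt n ])
                 × ¬ (mobiusSum G n ≡P zeroP [mod qInt n ]))
theorem10 = S-sequence.isQEulerGauss , G-sequence.isQEulerGauss
          , λ n composite sf → S-sequence.mobiusSum-≢0 n composite sf , G-sequence.mobiusSum-≢0 n composite sf
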